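{- Let $\circ\in\{\land,\lor\}$, let $r \in \mathbb N$ and let $S$ be the leftist circuit over $\{\circ\}$ on inputs $x_0, \dotsc, x_{r-1}$. Let $N \subseteq \{x_0,\dots,x_{r-1}\}$ be triangular with $|N| = n \geq 1$, and let $x_i \notin N$ be the input directly to the right of $N$ (i.e. $i$ is one more than the largest index of an input in $N$) such that $N \cup \{x_i\}$ is triangular. Let $K \subseteq N$ be the set computed by the procedure $\mathrm{TriSubset}(S,N)$. Then $(N \setminus K) \cup \{x_i\}$ is triangular.
   Context: Circuits: a circuit over $\{\circ\}$ on inputs $x_0,\dots,x_{r-1}$ is a finite directed acyclic graph whose sources are the input vertices and whose other vertices are gates, each with exactly two predecessors. For a vertex $v$, $\mathrm{In}_v(S)$ is the set of input vertices from which there is a directed path to $v$ ($\mathrm{In}_v(S)=\{v\}$ for an input). The depth of a vertex is the maximum number of edges on a directed path from an input to it. Leftist circuit: the circuit $S$ on $x_0,\dots,x_{r-1}$ constructed as follows. Set $i=0$, $M=r$; while $M \ge 2$: let $k$ be maximal with $2^k\le M$, add a perfect binary tree of $\circ$-gates of depth $k$ whose leaves, read from left to right, are $x_i,\dots,x_{i+2^k-1}$, then set $i\leftarrow i+2^k$, $M\leftarrow M-2^k$. Each vertex $v$ has $\mathrm{In}_v(S)=\{x_j: j\in I_v\}$ for an index interval $I_v$; $v$ is left of $w$ if $I_v\cap I_w=\emptyset$ and $\max I_v<\min I_w$. Boundary vertices: for $K\subseteq\{x_0,\dots,x_{r-1}\}$, $B(K,S)=\{v : \mathrm{In}_v(S)\subseteq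 K \text{ and } \mathrm{In}_w(S)\not\subseteq K \text{ for every successor } w \text{ of } v\}$. The boundary tree sequence $T_0,\dots,T_{|B|-1}$ of $K$ consists of the subcircuits formed by each boundary vertex $b$ together with all vertices having a directed path to $b$ (perfect binary trees), ordered from left to right; $\mathrm{depth}(T_j)$ is the depth of its root and $\mathrm{In}(T_j)$ its set of inputs. $K$ is triangular if there is $J\in\{0,\dots,|B|-1\}$ such that the inputs of $T_0,\dots,T_J$ form a set of inputs with consecutive indices, the inputs of $T_{J+1},\dots,T_{|B|-1}$ form a set of inputs with consecutive indices, $\mathrm{depth}(T_j)<\mathrm{depth}(T_{j+1})$ for $0\le j<J-1$, and $\mathrm{depth}(T_j)>\mathrm{depth}(T_{j+1})$ for $J+1\le j<|B|-1$; the empty set is also triangular. Procedure $\mathrm{TriSubset}(S,N)$ (for triangular $N$ with $2^{d-1}\le |N|<2^d$, $d\ge 1$): let $T_0,\dots,T_{p-1}$ be the boundary tree sequence of $N$. If some $T_j$ has depth $d-1$, return $\mathrm{In}(T_j)$. Otherwise let $D$ be the largest $d'$ such that there exist $j_0<j_1$ with $\mathrm{depth}(T_{j_0})=\mathrm{depth}(T_{j_1})=d'$, choose such $j_0<j_1$ with depth $D$, and return $\bigcup_{j=j_0}^{j_1}\mathrm{In}(T_j)$. -}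

module Defs where

open import Data.Nat using (ℕ; zero; suc; _+_; _∸_; _^_; _≤_; _<_)
open import Data.Nat.Logarithm using (⌊log₂_⌋)
open import Data.Nat.Divisibility using (_∣_)
open import Data.Product using (Σ; ∃; _×_; _,_; proj₁; proj₂)
open import Data.Sum using (_⊎_)
open import Data.List using (List; []; _∷_)
open import Data.List.Membership.Propositional using () renaming (_∈_ to _∈ₗ_)
open import Data.Fin using (Fin; toℕ)
open import Data.Fin.Subset using (Subset; _∈_)
open import Relation.Binary.PropositionalEquality using (_≡_; _≢_)
open import Relation.Nullary using (¬_)

-- The gate operation ∘ ∈ {∧, ∨}.  The (labelled) graph structure of the
-- leftist circuit does not depend on which one is chosen.

data GateOp : Set where
  and-op or-op : GateOp

-- A vertex is encoded as a pair (s , h) : the root of a perfect binary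
-- subtree of height h whose leftmost leaf is x_s.  Inputs are (j , 0).

Vertex : Set
Vertex = ℕ × ℕ

start : Vertex → ℕ
start = proj₁

depth : Vertex → ℕ
depth = proj₂

-- The perfect binary trees added by the construction, as pairs
-- (first leaf index i , tree depth k).  First argument is fuel.
blocksFrom : ℕ → ℕ → ℕ → List (ℕ × ℕ)
blocksFrom zero    i M             = []
blocksFrom (suc f) i zero          = []
blocksFrom (suc f) i (suc zero)    = []
blocksFrom (suc f) i (suc (suc m)) =
  (i , k) ∷ blocksFrom f (i + 2 ^ k) (suc (suc m) ∸ 2 ^ k)
  where
  k : ℕ
  k = ⌊log₂ (suc (suc m)) ⌋

blocks : ℕ → List (ℕ × ℕ)
blocks r = blocksFrom r 0 r

-- v is a vertex of S: an input x_s (s < r), or a node of one of the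
-- perfect trees (dyadically aligned subtree inside the block).
IsVertex : ℕ → Vertex → Set
IsVertex r (s , h) =
  (h ≡ 0 × s < r) ⊎
  Σ (ℕ × ℕ) λ bk → bk ∈ₗ blocks r ×
     (h ≤ proj₂ bk × proj₁ bk ≤ s × s + 2 ^ h ≤ proj₁ bk + 2 ^ proj₂ bk
      × (2 ^ h) ∣ (s ∸ proj₁ bk))

Edge : ℕ → Vertex → Vertex → Set
Edge r u w =
  IsVertex r u × IsVertex r w × depth w ≡ suc (depth u) ×
  (start u ≡ start w ⊎ start u ≡ start w + 2 ^ depth u)

data Path (r : ℕ) : Vertex → Vertex → Set where
  here  : ∀ {v} → IsVertex r v → Path r v v
  step  : ∀ {u w v} → Edge r u w → Path r w v → Path r u v

In : ℕ → Vertex → ℕ → Set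
In r v m = Path r (m , 0) v

_∈ℕ_ : {r : ℕ} → ℕ → Subset r → Set
_∈ℕ_ {r} m K = Σ (Fin r) λ a → toℕ a ≡ m × a ∈ K

InSub : (r : ℕ) → Vertex → Subset r → Set
InSub r v K = ∀ m → In r v m → m ∈ℕ K

Boundary : (r : ℕ) → Subset r → Vertex → Set
Boundary r K v =
  IsVertex r v × InSub r v K × (∀ w → Edge r v w → ¬ InSub r w K)

LeftOf : ℕ → Vertex → Vertex → Set
LeftOf r v w =
  (∀ m → ¬ (In r v m × In r w m)) ×
  (∀ a b → In r v a → In r w b → a < b)

IsBoundarySeq : (r : ℕ) → Subset r → (p : ℕ) → (ℕ → Vertex) → Set
IsBoundarySeq r K p T =
  (∀ j → j < p → Boundary r K (T j)) ×
  (∀ v → Boundary r K v → Σ ℕ λ j → j < p × T j ≡ v) ×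
  (∀ j j' → j < j' → j' < p → LeftOf r (T j) (T j'))

Consecutive : (ℕ → Set) → Set
Consecutive P = ∀ a b c → a ≤ b → b ≤ c → P a → P c → P b

TriangularSeq : ℕ → (p : ℕ) → (ℕ → Vertex) → Set
TriangularSeq r p T =
  p ≡ 0 ⊎
  Σ ℕ λ J → J < p ×
    Consecutive (λ m → Σ ℕ λ j → j ≤ J × In r (T j) m) ×
    Consecutive (λ m → Σ ℕ λ j → J < j × j < p × In r (T j) m) ×
    (∀ j → j < J → depth (T j) < depth (T (suc j))) ×
    (∀ j → suc J ≤ j → suc j < p → depth (T (suc j)) < depth (T j))

Triangular : (r : ℕ) → Subset r → Set
Triangular r K =
  Σ ℕ λ p → Σ (ℕ → Vertex) λ T → IsBoundarySeq r K p T × TriangularSeq r p T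

SameInputs : {r : ℕ} → Subset r → (ℕ → Set) → Set
SameInputs K P = ∀ m → (m ∈ℕ K → P m) × (P m → m ∈ℕ K)

-- K is a possible result of TriSubset(S, N), where n = |N| satisfies
-- 2^(d-1) ≤ n < 2^d, d ≥ 1 (the choices of j, j₀, j₁ are arbitrary).
TriSubsetResult : (r : ℕ) → (N : Subset r) → (n : ℕ) → Subset r → Set
TriSubsetResult r N n K =
  Σ ℕ λ d → 1 ≤ d × 2 ^ (d ∸ 1) ≤ n × n < 2 ^ d ×
  Σ ℕ λ p → Σ (ℕ → Vertex) λ T → IsBoundarySeq r N p T ×
  ( (Σ ℕ λ j → j < p × depth (T j) ≡ d ∸ 1 × SameInputs K (In r (T j)))
  ⊎ ((∀ j → j < p → depth (T j) ≢ d ∸ 1) ×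
     Σ ℕ λ j₀ → Σ ℕ λ j₁ → j₀ < j₁ × j₁ < p × depth (T j₀) ≡ depth (T j₁) ×
       (∀ j j' → j < j' → j' < p → depth (T j) ≡ depth (T j') →
          depth (T j) ≤ depth (T j₀)) ×
       SameInputs K (λ m → Σ ℕ λ j → j₀ ≤ j × j ≤ j₁ × In r (T j) m)) )

-- Every vertex of the leftist circuit is the root of a perfect binary tree over a
-- dyadically aligned interval of inputs inside one block, so two vertices sharing
-- an input are nested and a boundary sequence is determined by its set.  Let
-- T' 0, …, T' qL be the boundary sequence of N ∪ {x_i}, with peak J', and L = T' qL
-- the tree containing x_i.  The boundary trees of N are T' 0, …, T' (qL - 1)
-- followed by the left children hanging off the path from x_i up to L.  As
-- n < 2 ^ d, N has no two disjoint trees of depth d - 1: so a tree of depth d - 1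
-- of N is T' J', T' (J' + 1), or a spine child of L when L is the only tree, and
-- two trees of equal depth lie on opposite sides of the peak unless the right one
-- is a spine child.  Hence K is an interval of N starting at some T' a with
-- a ≤ J' + 1 and either made of whole trees crossing the peak or ending at a spine
-- child of L.  What remains of N ∪ {x_i} is T' 0, …, T' (a - 1), the trees after
-- K, and a last tree ending at x_i (L itself, or the sibling of the last removed
-- spine child): again increasing up to a - 1 and decreasing afterwards.

module Submission where

open import Data.Empty using (⊥; ⊥-elim)
open import Data.Fin as Fin using (Fin; toℕ; fromℕ<)
open import Data.Fin.Properties using (toℕ<n; toℕ-fromℕ<; toℕ-injective)
open import Data.Fin.Subset using (Subset; _∈_; _∉_; _∪_; _─_; ⁅_⁆; ∣_∣; inside; outside)
open import Data.Fin.Subset.Properties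
  using (_∈?_; x∈p∪q⁻; x∈p∪q⁺; x∈⁅y⁆⇒x≡y; x∈⁅x⁆; x∈p∧x∉q⇒x∈p─q; p─q⊆p)
open import Data.List using (List; []; _∷_)
open import Data.List.Membership.Propositional using () renaming (_∈_ to _∈ₗ_)
open import Data.List.Relation.Unary.Any using (here; there)
open import Data.Nat
open import Data.Nat.Divisibility using (_∣_; divides; _∣?_)
open import Data.Nat.Properties
open import Data.Product using (Σ; _×_; _,_; proj₁; proj₂)
open import Data.Sum using (_⊎_; inj₁; inj₂)
open import Data.Vec.Base using ([]; _∷_; here; there)
open import Function using (_∘_)
open import Relation.Binary.Definitions using (tri<; tri≈; tri>)
open import Relation.Binary.PropositionalEquality
open import Relation.Nullary using (¬_; Dec; yes; no)
open import Relation.Nullary.Decidable using (_×-dec_; _⊎-dec_)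

open import Defs

2^-suc : ∀ h → 2 ^ suc h ≡ 2 ^ h + 2 ^ h
2^-suc h = cong (2 ^ h +_) (+-identityʳ (2 ^ h))

2^>0 : ∀ h → 0 < 2 ^ h
2^>0 h = m^n>0 2 h

2^-mono-≤ : ∀ {h k} → h ≤ k → 2 ^ h ≤ 2 ^ k
2^-mono-≤ h≤k = ^-monoʳ-≤ 2 h≤k

2^-mono-< : ∀ {h k} → h < k → 2 ^ h < 2 ^ k
2^-mono-< h<k = ^-monoʳ-< 2 (s≤s (s≤s z≤n)) h<k

n<2^n : ∀ h → h < 2 ^ h
n<2^n zero = s≤s z≤n
n<2^n (suc h) rewrite 2^-suc h = +-mono-≤-< (2^>0 h) (n<2^n h)

2^-∣ : ∀ {h k} → h ≤ k → 2 ^ h ∣ 2 ^ k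
2^-∣ {h} {k} h≤k with m≤n⇒∃[o]m+o≡n h≤k
... | o , refl = divides (2 ^ o) (trans (^-distribˡ-+-* 2 h o) (*-comm (2 ^ h) (2 ^ o)))

double-*-2^ : ∀ j h → (j + j) * 2 ^ h ≡ j * 2 ^ suc h
double-*-2^ j h = begin
  (j + j) * 2 ^ h         ≡⟨ *-distribʳ-+ (2 ^ h) j j ⟩
  j * 2 ^ h + j * 2 ^ h   ≡⟨ *-distribˡ-+ j (2 ^ h) (2 ^ h) ⟨
  j * (2 ^ h + 2 ^ h)     ≡⟨ cong (j *_) (2^-suc h) ⟨
  j * 2 ^ suc h           ∎
  where open ≡-Reasoning

m<n+1⇒m≤n : ∀ {m n} → m < n + 1 → m ≤ n
m<n+1⇒m≤n {m} {n} lt = +-cancelʳ-≤ 1 m n (subst (_≤ n + 1) (+-comm 1 m) lt)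

even⊎odd : ∀ q → (Σ ℕ λ k → q ≡ k + k) ⊎ (Σ ℕ λ k → q ≡ suc (k + k))
even⊎odd zero = inj₁ (0 , refl)
even⊎odd (suc q) with even⊎odd q
... | inj₁ (k , refl) = inj₂ (k , refl)
... | inj₂ (k , refl) = inj₁ (suc k , cong suc (sym (+-suc k k)))

Aligned : ℕ → ℕ → ℕ → Set
Aligned a b s = Σ ℕ λ q → s ≡ b + q * a

Aligned-refl : ∀ {a b} → Aligned a b b
Aligned-refl {a} {b} = 0 , sym (+-identityʳ b)

Aligned-trans : ∀ {a b c s} → Aligned a b c → Aligned a c s → Aligned a b s
Aligned-trans {a} {b} (q , refl) (q' , refl) =
  q + q' , trans (+-assoc b (q * a) (q' * a)) (cong (b +_) (sym (*-distribʳ-+ a q q')))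

Aligned-+ : ∀ {a b s} → Aligned a b s → Aligned a b (s + a)
Aligned-+ {a} {b} (q , refl) = suc q , trans (+-assoc b (q * a) a) (cong (b +_) (+-comm (q * a) a))

Aligned-pred : ∀ {h b s} → Aligned (2 ^ h) b (s + 2 ^ h) → b ≤ s → Aligned (2 ^ h) b s
Aligned-pred {h} {b} {s} (zero , eq) b≤s =
  ⊥-elim (<-irrefl refl (<-≤-trans (m<m+n s (2^>0 h)) (subst (_≤ s) (sym (trans eq (+-identityʳ b))) b≤s)))
Aligned-pred {h} {b} {s} (suc q , eq) b≤s = q , +-cancelʳ-≡ (2 ^ h) s (b + q * 2 ^ h)
  (trans eq (trans (cong (b +_) (+-comm (2 ^ h) (q * 2 ^ h))) (sym (+-assoc b _ _))))

Aligned-weaken : ∀ {a A b s} → a ∣ A → Aligned A b s → Aligned a b s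
Aligned-weaken {a} {A} {b} (divides c refl) (q , refl) = q * c , cong (b +_) (sym (*-assoc q c a))

Aligned-rebase : ∀ {h b x y} → Aligned (2 ^ h) b x → Aligned (2 ^ h) b y → x ≤ y → Aligned (2 ^ h) x y
Aligned-rebase {h} {b} (qx , refl) (qy , refl) le
  with m≤n⇒∃[o]m+o≡n (*-cancelʳ-≤ qx qy (2 ^ h) {{m^n≢0 2 h}} (+-cancelˡ-≤ b _ _ le))
... | o , refl = o , trans (cong (b +_) (*-distribʳ-+ (2 ^ h) qx o)) (sym (+-assoc b _ _))

∣⇒Aligned : ∀ {a b s} → b ≤ s → a ∣ s ∸ b → Aligned a b s
∣⇒Aligned {a} {b} {s} b≤s (divides q eq) = q , (begin
  s           ≡⟨ m+[n∸m]≡n b≤s ⟨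
  b + (s ∸ b) ≡⟨ cong (b +_) eq ⟩
  b + q * a   ∎)
  where open ≡-Reasoning

Aligned⇒∣ : ∀ {a b s} → Aligned a b s → a ∣ s ∸ b
Aligned⇒∣ {a} {b} (q , refl) = divides q (m+n∸m≡n b (q * a))

Aligned-gap : ∀ {a b x y} → Aligned a b x → Aligned a b y → x < y → x + a ≤ y
Aligned-gap {a} {b} (q1 , refl) (q2 , refl) x<y with q1 <? q2
... | yes q1<q2 = begin
     b + q1 * a + a   ≡⟨ +-assoc b (q1 * a) a ⟩
     b + (q1 * a + a) ≡⟨ cong (b +_) (+-comm (q1 * a) a) ⟩
     b + suc q1 * a   ≤⟨ +-monoʳ-≤ b (*-monoˡ-≤ a q1<q2) ⟩
     b + q2 * a       ∎
  where open ≤-Reasoning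
... | no q1≮q2 = ⊥-elim (<⇒≱ x<y (+-monoʳ-≤ b (*-monoˡ-≤ a (≮⇒≥ q1≮q2))))

-- Vertices of the leftist circuit as intervals of inputs

end : Vertex → ℕ
end v = start v + 2 ^ depth v

record Covers (v : Vertex) (m : ℕ) : Set where
  constructor covers
  field
    start≤ : start v ≤ m
    <end : m < end v
open Covers public

record _⊑_ (u v : Vertex) : Set where
  constructor nested
  field
    ⊑-start : start v ≤ start u
    ⊑-end : end u ≤ end v
open _⊑_ public

⊑-refl : ∀ {v} → v ⊑ v
⊑-refl = nested ≤-refl ≤-refl

⊑-trans : ∀ {u v w} → u ⊑ v → v ⊑ w → u ⊑ w
⊑-trans (nested a b) (nested c d) = nested (≤-trans c a) (≤-trans b d)

⊑-covers : ∀ {u v m} → u ⊑ v → Covers u m → Covers v m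
⊑-covers (nested a b) (covers c d) = covers (≤-trans a c) (<-≤-trans d b)

covers-start : ∀ v → Covers v (start v)
covers-start v = covers ≤-refl (m<m+n (start v) (2^>0 (depth v)))

covers-pred-end : ∀ v {y} → suc y ≡ end v → Covers v y
covers-pred-end v {y} eq = covers
  (s≤s⁻¹ (subst₂ _≤_ (+-comm (start v) 1) (sym eq) (+-monoʳ-≤ (start v) (2^>0 (depth v)))))
  (subst (y <_) eq ≤-refl)

lastOf : Vertex → ℕ
lastOf v = start v + pred (2 ^ depth v)

suc-lastOf : ∀ v → suc (lastOf v) ≡ end v
suc-lastOf v = trans (sym (+-suc (start v) _)) (cong (start v +_) (suc-pred (2 ^ depth v) {{m^n≢0 2 (depth v)}}))

covers-lastOf : ∀ v → Covers v (lastOf v)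
covers-lastOf v = covers-pred-end v (suc-lastOf v)

Covers? : ∀ v m → Dec (Covers v m)
Covers? v m with start v ≤? m | m <? end v
... | yes a | yes b = yes (covers a b)
... | no a | _ = no (a ∘ start≤)
... | _ | no b = no (b ∘ <end)

covers-depth-0 : ∀ {s m} → Covers (s , 0) m → m ≡ s
covers-depth-0 (covers a b) = ≤-antisym (m<n+1⇒m≤n b) a

vertex-≡ : ∀ {u v : Vertex} → start u ≡ start v → depth u ≡ depth v → u ≡ v
vertex-≡ refl refl = refl

Aligned-nested : ∀ {b s₁ s₂ h₁ h₂ m} → h₁ ≤ h₂ →
  Aligned (2 ^ h₁) b s₁ → Aligned (2 ^ h₂) b s₂ →
  Covers (s₁ , h₁) m → Covers (s₂ , h₂) m → (s₁ , h₁) ⊑ (s₂ , h₂)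
Aligned-nested {b} {s₁} {s₂} {h₁} {h₂} h≤ al₁ al₂ (covers a₁ b₁) (covers a₂ b₂) =
  nested s₂≤s₁ (Aligned-gap al₁ al₂-end (≤-<-trans a₁ b₂))
  where
  s₂≤s₁ : s₂ ≤ s₁
  s₂≤s₁ with s₁ <? s₂
  ... | yes s₁<s₂ = ⊥-elim (<⇒≱ b₁ (≤-trans (Aligned-gap al₁ (Aligned-weaken (2^-∣ h≤) al₂) s₁<s₂) a₂))
  ... | no s₁≮s₂ = ≮⇒≥ s₁≮s₂
  al₂-end : Aligned (2 ^ h₁) b (s₂ + 2 ^ h₂)
  al₂-end = Aligned-weaken (2^-∣ h≤) (Aligned-+ al₂)

blocksFrom-start≥ : ∀ f i M bk → bk ∈ₗ blocksFrom f i M → i ≤ proj₁ bk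
blocksFrom-start≥ zero i M bk ()
blocksFrom-start≥ (suc f) i zero bk ()
blocksFrom-start≥ (suc f) i (suc zero) bk ()
blocksFrom-start≥ (suc f) i (suc (suc m)) bk (here refl) = ≤-refl
blocksFrom-start≥ (suc f) i (suc (suc m)) bk (there p) =
  ≤-trans (m≤m+n i _) (blocksFrom-start≥ f _ _ bk p)

blocksFrom-disjoint : ∀ f i M bk₁ bk₂ m → bk₁ ∈ₗ blocksFrom f i M → bk₂ ∈ₗ blocksFrom f i M →
  proj₁ bk₁ ≤ m → m < proj₁ bk₁ + 2 ^ proj₂ bk₁ →
  proj₁ bk₂ ≤ m → m < proj₁ bk₂ + 2 ^ proj₂ bk₂ → bk₁ ≡ bk₂
blocksFrom-disjoint zero i M bk₁ bk₂ m () _ a b c d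
blocksFrom-disjoint (suc f) i zero bk₁ bk₂ m () _ a b c d
blocksFrom-disjoint (suc f) i (suc zero) bk₁ bk₂ m () _ a b c d
blocksFrom-disjoint (suc f) i (suc (suc M)) bk₁ bk₂ m (here refl) (here refl) a b c d = refl
blocksFrom-disjoint (suc f) i (suc (suc M)) bk₁ bk₂ m (here refl) (there q) a b c d =
  ⊥-elim (<⇒≱ b (≤-trans (blocksFrom-start≥ f _ _ bk₂ q) c))
blocksFrom-disjoint (suc f) i (suc (suc M)) bk₁ bk₂ m (there q) (here refl) a b c d =
  ⊥-elim (<⇒≱ d (≤-trans (blocksFrom-start≥ f _ _ bk₁ q) a))
blocksFrom-disjoint (suc f) i (suc (suc M)) bk₁ bk₂ m (there q) (there q') a b c d =
  blocksFrom-disjoint f _ _ bk₁ bk₂ m q q' a b c d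

IsVertex-sub : ∀ {r v s h} → IsVertex r v → h ≤ depth v → start v ≤ s → s + 2 ^ h ≤ end v →
  Aligned (2 ^ h) (start v) s → IsVertex r (s , h)
IsVertex-sub {r} {sv , .0} {s} {.0} (inj₁ (refl , sv<r)) z≤n sv≤s e al =
  inj₁ (refl , ≤-<-trans (+-cancelʳ-≤ 1 s sv e) sv<r)
IsVertex-sub {r} {sv , hv} {s} {h} (inj₂ ((b , k) , mem , hv≤k , b≤sv , e' , dv)) h≤hv sv≤s e al =
  inj₂ ((b , k) , mem , ≤-trans h≤hv hv≤k , ≤-trans b≤sv sv≤s , ≤-trans e e' ,
        Aligned⇒∣ (Aligned-trans (Aligned-weaken (2^-∣ h≤hv) (∣⇒Aligned b≤sv dv)) al))

vertex-block : ∀ {r s h} → IsVertex r (s , h) → 0 < h →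
  Σ (ℕ × ℕ) λ bk → bk ∈ₗ blocks r × h ≤ proj₂ bk × proj₁ bk ≤ s ×
     s + 2 ^ h ≤ proj₁ bk + 2 ^ proj₂ bk × Aligned (2 ^ h) (proj₁ bk) s
vertex-block (inj₁ (refl , _)) ()
vertex-block (inj₂ (bk , mem , a , b , c , d)) _ = bk , mem , a , b , c , ∣⇒Aligned b d

vertex-aligned-in-block : ∀ {r u b k} → IsVertex r u → (b , k) ∈ₗ blocks r → b ≤ start u →
  start u < b + 2 ^ k → Aligned (2 ^ depth u) b (start u)
vertex-aligned-in-block {r} {su , zero} {b} iu mem b≤ lt =
  su ∸ b , trans (sym (m+[n∸m]≡n b≤)) (cong (b +_) (sym (*-identityʳ (su ∸ b))))
vertex-aligned-in-block {r} {su , suc hu} {b} {k} iu mem b≤ lt with vertex-block iu (s≤s z≤n)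
... | bk' , mem' , _ , x , y , al
  with blocksFrom-disjoint r 0 r bk' (b , k) su mem' mem x (<-≤-trans (m<m+n su (2^>0 (suc hu))) y) b≤ lt
... | refl = al

Edge⇒⊑ : ∀ {r u w} → Edge r u w → u ⊑ w
Edge⇒⊑ {r} {su , hu} {sw , .(suc hu)} (_ , _ , refl , inj₁ refl) =
  nested ≤-refl (+-monoʳ-≤ sw (2^-mono-≤ (n≤1+n hu)))
Edge⇒⊑ {r} {su , hu} {sw , .(suc hu)} (_ , _ , refl , inj₂ refl) =
  nested (m≤m+n sw _) (≤-reflexive (trans (+-assoc sw _ _) (cong (sw +_) (sym (2^-suc hu)))))

Path⇒⊑ : ∀ {r u v} → Path r u v → u ⊑ v
Path⇒⊑ (here _) = ⊑-refl
Path⇒⊑ (step e p) = ⊑-trans (Edge⇒⊑ e) (Path⇒⊑ p)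

Path-snoc : ∀ {r u w v} → Path r u w → Edge r w v → Path r u v
Path-snoc (here x) e = step e (here (proj₁ (proj₂ e)))
Path-snoc (step e' p) e = step e' (Path-snoc p e)

In⇒Covers : ∀ {r v m} → In r v m → Covers v m
In⇒Covers {r} {v} {m} p with Path⇒⊑ p
... | nested a b = covers a (subst (_≤ end v) (+-comm m 1) b)

Covers⇒In : ∀ {r v m} → IsVertex r v → Covers v m → In r v m
Covers⇒In {r} {s , h} = descend h s
  where
  descend : ∀ {m} h s → IsVertex r (s , h) → Covers (s , h) m → In r (s , h) m
  descend zero s iv c rewrite covers-depth-0 c = here iv
  descend {m} (suc h) s iv (covers s≤m m<) with m <? s + 2 ^ h
  ... | yes m<mid = Path-snoc (descend h s left (covers s≤m m<mid)) (left , iv , refl , inj₁ refl)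
    where
    left : IsVertex r (s , h)
    left = IsVertex-sub iv (n≤1+n h) ≤-refl (+-monoʳ-≤ s (2^-mono-≤ (n≤1+n h))) Aligned-refl
  ... | no m≮mid = Path-snoc (descend h (s + 2 ^ h) right (covers (≮⇒≥ m≮mid) m<end)) (right , iv , refl , inj₂ refl)
    where
    split : s + 2 ^ suc h ≡ s + 2 ^ h + 2 ^ h
    split = trans (cong (s +_) (2^-suc h)) (sym (+-assoc s _ _))
    m<end : m < s + 2 ^ h + 2 ^ h
    m<end = subst (m <_) split m<
    right : IsVertex r (s + 2 ^ h , h)
    right = IsVertex-sub iv (n≤1+n h) (m≤m+n s _) (≤-reflexive (sym split)) (Aligned-+ Aligned-refl)

laminar : ∀ {r u v m} → IsVertex r u → IsVertex r v → depth u ≤ depth v →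
  Covers u m → Covers v m → u ⊑ v
laminar {r} {su , zero} {v} iu iv le cu (covers c d) rewrite covers-depth-0 cu =
  nested c (subst (_≤ end v) (+-comm 1 su) d)
laminar {r} {su , suc hu} {sv , hv} {m} iu iv le cu@(covers a b) cv@(covers c d)
  with vertex-block iu (s≤s z≤n) | vertex-block iv (<-≤-trans (s≤s z≤n) le)
... | (b₁ , k₁) , mem₁ , _ , x₁ , y₁ , al₁ | (b₂ , k₂) , mem₂ , _ , x₂ , y₂ , al₂
  with blocksFrom-disjoint r 0 r (b₁ , k₁) (b₂ , k₂) m mem₁ mem₂ (≤-trans x₁ a) (<-≤-trans b y₁)
         (≤-trans x₂ c) (<-≤-trans d y₂)
... | refl = Aligned-nested le al₁ al₂ cu cv

-- Whether u is the left or the right child of its parent is read off from the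
-- parity of the index of u among the depth-(depth u) vertices of its block.
parent-within : ∀ {r u v} → IsVertex r u → IsVertex r v → depth u < depth v → u ⊑ v →
  Σ Vertex λ w → Edge r u w × w ⊑ v
parent-within {r} {su , hu} {sv , hv} iu iv lt (nested c₁ c₂)
  with vertex-block iv (<-≤-trans (s≤s z≤n) lt)
... | (b , k) , mem , hv≤k , b≤sv , e , alv
  with vertex-aligned-in-block iu mem (≤-trans b≤sv c₁) (<-≤-trans (<-≤-trans (m<m+n su (2^>0 hu)) c₂) e)
... | (q , eq) = by-parity (even⊎odd q)
  where
  a = 2 ^ hu
  su<end : ∀ {e} → su + a ≤ e → su < e
  su<end = <-≤-trans (m<m+n su (2^>0 hu))
  parent : ∀ sw → Aligned (2 ^ suc hu) b sw → sw ≤ su → su + a ≤ sw + 2 ^ suc hu →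
    (su ≡ sw ⊎ su ≡ sw + a) → Σ Vertex λ w → Edge r (su , hu) w × w ⊑ (sv , hv)
  parent sw alw sw≤su cont rel = (sw , suc hu) , (iu , iw , refl , rel) , w⊑v
    where
    w⊑v : (sw , suc hu) ⊑ (sv , hv)
    w⊑v = Aligned-nested lt alw alv (covers sw≤su (su<end cont)) (covers c₁ (su<end c₂))
    iw : IsVertex r (sw , suc hu)
    iw = IsVertex-sub iv lt (⊑-start w⊑v) (⊑-end w⊑v)
           (Aligned-rebase {h = suc hu} (Aligned-weaken (2^-∣ lt) alv) alw (⊑-start w⊑v))
  by-parity : (Σ ℕ λ j → q ≡ j + j) ⊎ (Σ ℕ λ j → q ≡ suc (j + j)) →
    Σ Vertex λ w → Edge r (su , hu) w × w ⊑ (sv , hv)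
  by-parity (inj₁ (j , refl)) = parent su (j , trans eq (cong (b +_) (double-*-2^ j hu))) ≤-refl
    (+-monoʳ-≤ su (2^-mono-≤ (n≤1+n hu))) (inj₁ refl)
  by-parity (inj₂ (j , refl)) = parent (b + j * 2 ^ suc hu) (j , refl) (subst (_ ≤_) (sym su≡) (m≤m+n _ _))
      (≤-reflexive (trans (cong (_+ a) su≡) (trans (+-assoc _ a a) (cong ((b + j * 2 ^ suc hu) +_) (sym (2^-suc hu))))))
      (inj₂ su≡)
    where
    su≡ : su ≡ b + j * 2 ^ suc hu + a
    su≡ = trans eq (trans (cong (b +_) (trans (cong (a +_) (double-*-2^ j hu)) (+-comm a _))) (sym (+-assoc b _ a)))

InSub⇒∈ℕ : ∀ {r v X m} → IsVertex r v → InSub r v X → Covers v m → m ∈ℕ X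
InSub⇒∈ℕ iv is x = is _ (Covers⇒In iv x)

∈ℕ⇒InSub : ∀ {r v X} → (∀ m → Covers v m → m ∈ℕ X) → InSub r v X
∈ℕ⇒InSub f m p = f m (In⇒Covers p)

InSub-⊑ : ∀ {r u v X} → IsVertex r v → u ⊑ v → InSub r v X → InSub r u X
InSub-⊑ iv uv is = ∈ℕ⇒InSub λ m x → InSub⇒∈ℕ iv is (⊑-covers uv x)

InSub-mono : ∀ {r v} {X Y : Subset r} → (∀ {m} → m ∈ℕ X → m ∈ℕ Y) → InSub r v X → InSub r v Y
InSub-mono X⊆Y is m p = X⊆Y (is m p)

Boundary-⊆ : ∀ {r v} {X Y : Subset r} → (∀ {m} → m ∈ℕ X → m ∈ℕ Y) →
  Boundary r Y v → InSub r v X → Boundary r X v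
Boundary-⊆ X⊆Y (iv , _ , maxY) isX = iv , isX , λ w e isw → maxY w e (InSub-mono X⊆Y isw)

∈ℕ⇒< : ∀ {r m} {X : Subset r} → m ∈ℕ X → m < r
∈ℕ⇒< (a , refl , _) = toℕ<n a

Boundary-unique-≤ : ∀ {r X b₁ b₂ m} → Boundary r X b₁ → Boundary r X b₂ → depth b₁ ≤ depth b₂ →
  Covers b₁ m → Covers b₂ m → b₁ ≡ b₂
Boundary-unique-≤ {r} {X} {b₁} {b₂} (iv₁ , is₁ , max₁) (iv₂ , is₂ , _) le x₁ x₂
  with laminar iv₁ iv₂ le x₁ x₂ | m≤n⇒m<n∨m≡n le
... | b₁⊑b₂ | inj₁ lt with parent-within iv₁ iv₂ lt b₁⊑b₂
...   | w , e , w⊑ = ⊥-elim (max₁ w e (InSub-⊑ iv₂ w⊑ is₂))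
Boundary-unique-≤ {r} {X} {b₁} {b₂} _ _ le x₁ x₂ | nested a b | inj₂ eq =
  vertex-≡ (≤-antisym (+-cancelʳ-≤ (2 ^ depth b₂) _ _ (subst (λ z → start b₁ + 2 ^ z ≤ end b₂) eq b)) a) eq

Boundary-unique : ∀ {r X b₁ b₂ m} → Boundary r X b₁ → Boundary r X b₂ →
  Covers b₁ m → Covers b₂ m → b₁ ≡ b₂
Boundary-unique {b₁ = b₁} {b₂} B₁ B₂ x₁ x₂ with ≤-total (depth b₁) (depth b₂)
... | inj₁ le = Boundary-unique-≤ B₁ B₂ le x₁ x₂
... | inj₂ le = sym (Boundary-unique-≤ B₂ B₁ le x₂ x₁)

_∈ℕ?_ : ∀ {r} m (X : Subset r) → Dec (m ∈ℕ X)
_∈ℕ?_ {r} m X with m <? r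
... | no m≮r = no λ x → m≮r (∈ℕ⇒< x)
... | yes m<r with fromℕ< m<r ∈? X
...   | yes p = yes (fromℕ< m<r , toℕ-fromℕ< m<r , p)
...   | no np = no λ { (a , eq , a∈) →
          np (subst (_∈ X) (toℕ-injective (trans eq (sym (toℕ-fromℕ< m<r)))) a∈) }

all-in-range? : (P : ℕ → Set) → (∀ m → Dec (P m)) → ∀ s L → Dec (∀ m → s ≤ m → m < s + L → P m)
all-in-range? P P? s zero = yes λ m a b → ⊥-elim (<⇒≱ b (subst (_≤ m) (sym (+-identityʳ s)) a))
all-in-range? P P? s (suc L) with all-in-range? P P? s L | P? (s + L)
... | no ¬all | _ = no λ f → ¬all λ m a b → f m a (<-trans b (+-monoʳ-< s (n<1+n L)))
... | yes _ | no ¬last = no λ f → ¬last (f (s + L) (m≤m+n s L) (+-monoʳ-< s (n<1+n L)))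
... | yes all | yes last = yes all′
  where
  all′ : ∀ m → s ≤ m → m < s + suc L → P m
  all′ m a b with m≤n⇒m<n∨m≡n (m<n+1⇒m≤n (subst (m <_) (sym (+-assoc s L 1)) (subst (λ z → m < s + z) (+-comm 1 L) b)))
  ... | inj₁ lt = all m a lt
  ... | inj₂ refl = last

InSub? : ∀ {r v} (X : Subset r) → IsVertex r v → Dec (InSub r v X)
InSub? {r} {v} X iv with all-in-range? (_∈ℕ X) (_∈ℕ? X) (start v) (2 ^ depth v)
... | yes f = yes (∈ℕ⇒InSub λ m x → f m (start≤ x) (<end x))
... | no n = no λ is → n λ m a b → InSub⇒∈ℕ iv is (covers a b)

any-block? : {P : ℕ × ℕ → Set} → (∀ bk → Dec (P bk)) → ∀ xs → Dec (Σ (ℕ × ℕ) λ bk → bk ∈ₗ xs × P bk)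
any-block? P? [] = no λ { (_ , () , _) }
any-block? P? (x ∷ xs) with P? x | any-block? P? xs
... | yes p | _ = yes (x , here refl , p)
... | no _ | yes (bk , m , p) = yes (bk , there m , p)
... | no ¬p | no ¬rest = no λ { (bk , here refl , p) → ¬p p ; (bk , there m , p) → ¬rest (bk , m , p) }

IsVertex? : ∀ r v → Dec (IsVertex r v)
IsVertex? r (s , h) = ((h ≟ 0) ×-dec (s <? r)) ⊎-dec
  any-block? (λ bk → (h ≤? proj₂ bk) ×-dec (proj₁ bk ≤? s) ×-dec (s + 2 ^ h ≤? proj₁ bk + 2 ^ proj₂ bk)
                 ×-dec ((2 ^ h) ∣? (s ∸ proj₁ bk))) (blocks r)

range-length≤ : ∀ {r} s L → (∀ m → s ≤ m → m < s + L → m < r) → L ≤ r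
range-length≤ s zero f = z≤n
range-length≤ {r} s (suc L) f = ≤-trans (s≤s (m≤n+m L s)) (f (s + L) (m≤m+n s L) (+-monoʳ-< s (n<1+n L)))

-- The fuel cannot run out: a vertex with all its 2 ^ depth inputs in X has depth < r.
climb-to-boundary : ∀ {r} (X : Subset r) f v → r ≤ depth v + f → IsVertex r v → InSub r v X →
  Σ Vertex λ b → Boundary r X b × v ⊑ b
climb-to-boundary {r} X zero v le iv is =
  ⊥-elim (<⇒≱ (<-≤-trans (n<2^n (depth v)) size≤r) (subst (r ≤_) (+-identityʳ _) le))
  where
  size≤r : 2 ^ depth v ≤ r
  size≤r = range-length≤ (start v) (2 ^ depth v) λ m a b → ∈ℕ⇒< (InSub⇒∈ℕ iv is (covers a b))
climb-to-boundary {r} X (suc f) (s , h) le iv is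
  with candidate? (s , suc h) | (2 ^ h ≤? s) ×-dec candidate? (s ∸ 2 ^ h , suc h)
  where
  candidate? : ∀ w → Dec (IsVertex r w × InSub r w X)
  candidate? w with IsVertex? r w
  ... | no n = no (n ∘ proj₁)
  ... | yes iw with InSub? X iw
  ...   | yes is' = yes (iw , is')
  ...   | no n = no (n ∘ proj₂)
... | yes (iw , is′) | _ =
  let (b , B , w⊑) = climb-to-boundary X f (s , suc h) (subst (r ≤_) (+-suc h f) le) iw is′
  in b , B , ⊑-trans (Edge⇒⊑ {r} {s , h} (iv , iw , refl , inj₁ refl)) w⊑
... | no _ | yes (le′ , iw , is′) =
  let (b , B , w⊑) = climb-to-boundary X f (s ∸ 2 ^ h , suc h) (subst (r ≤_) (+-suc h f) le) iw is′
  in b , B , ⊑-trans (Edge⇒⊑ {r} {s , h} (iv , iw , refl , inj₂ (sym (m∸n+n≡m le′)))) w⊑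
... | no ¬left | no ¬right = (s , h) , (iv , is , maximal) , ⊑-refl
  where
  maximal : ∀ w → Edge r (s , h) w → ¬ InSub r w X
  maximal (sw , .(suc h)) (_ , iw , refl , inj₁ refl) isw = ¬left (iw , isw)
  maximal (sw , .(suc h)) (_ , iw , refl , inj₂ refl) isw =
    ¬right (m≤n+m _ sw , subst (λ z → IsVertex r (z , suc h)) (sym (m+n∸n≡m sw (2 ^ h))) iw ,
            subst (λ z → InSub r (z , suc h) X) (sym (m+n∸n≡m sw (2 ^ h))) isw)

climb-from-input : ∀ {r m} (X : Subset r) → m ∈ℕ X → Σ Vertex λ b → Boundary r X b × Covers b m
climb-from-input {r} {m} X m∈X
  with climb-to-boundary X r (m , 0) ≤-refl (inj₁ (refl , ∈ℕ⇒< m∈X))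
         (∈ℕ⇒InSub λ k c → subst (_∈ℕ X) (sym (covers-depth-0 c)) m∈X)
... | b , B , m⊑b = b , B , ⊑-covers m⊑b (covers-start (m , 0))

∈ℕ-tail : ∀ {r m x} {X : Subset r} → suc m ∈ℕ (x ∷ X) → m ∈ℕ X
∈ℕ-tail (Fin.zero , () , _)
∈ℕ-tail (Fin.suc a , eq , there p) = a , suc-injective eq , p

∈ℕ-head : ∀ {r x} {X : Subset r} → 0 ∈ℕ (x ∷ X) → x ≡ inside
∈ℕ-head (Fin.zero , refl , here) = refl
∈ℕ-head (Fin.suc a , () , _)

∈ℕ-[] : ∀ {m} → ¬ (m ∈ℕ ([] {A = _}))
∈ℕ-[] (() , _)

∣∣-∷-≤ : ∀ {r} x (X : Subset r) → ∣ X ∣ ≤ ∣ x ∷ X ∣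
∣∣-∷-≤ inside X = n≤1+n _
∣∣-∷-≤ outside X = ≤-refl

Full : ∀ {r} → Subset r → ℕ → ℕ → Set
Full X s l = ∀ m → s ≤ m → m < s + l → m ∈ℕ X

Full-tail : ∀ {r x s l} {X : Subset r} → Full (x ∷ X) (suc s) l → Full X s l
Full-tail f m a b = ∈ℕ-tail (f (suc m) (s≤s a) (s≤s b))

Full-tail₀ : ∀ {r x l} {X : Subset r} → Full (x ∷ X) 0 (suc l) → Full X 0 l
Full-tail₀ f m a b = ∈ℕ-tail (f (suc m) z≤n (s≤s b))

Full⇒≤∣∣ : ∀ {r} (X : Subset r) s l → Full X s l → l ≤ ∣ X ∣
Full⇒≤∣∣ X s zero f = z≤n
Full⇒≤∣∣ [] s (suc l) f = ⊥-elim (∈ℕ-[] (f s ≤-refl (m<m+n s (s≤s z≤n))))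
Full⇒≤∣∣ (x ∷ X) (suc s) (suc l) f = ≤-trans (Full⇒≤∣∣ X s (suc l) (Full-tail f)) (∣∣-∷-≤ x X)
Full⇒≤∣∣ (x ∷ X) zero (suc l) f with ∈ℕ-head (f 0 z≤n (s≤s z≤n))
... | refl = s≤s (Full⇒≤∣∣ X 0 l (Full-tail₀ f))

Full²⇒≤∣∣ : ∀ {r} (X : Subset r) s₁ l₁ s₂ l₂ → s₁ + l₁ ≤ s₂ →
  Full X s₁ l₁ → Full X s₂ l₂ → l₁ + l₂ ≤ ∣ X ∣
Full²⇒≤∣∣ X s₁ zero s₂ l₂ le f₁ f₂ = Full⇒≤∣∣ X s₂ l₂ f₂
Full²⇒≤∣∣ [] s₁ (suc l₁) s₂ l₂ le f₁ f₂ = ⊥-elim (∈ℕ-[] (f₁ s₁ ≤-refl (m<m+n s₁ (s≤s z≤n))))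
Full²⇒≤∣∣ (x ∷ X) (suc s₁) (suc l₁) (suc s₂) l₂ (s≤s le) f₁ f₂ =
  ≤-trans (Full²⇒≤∣∣ X s₁ (suc l₁) s₂ l₂ le (Full-tail f₁) (Full-tail f₂)) (∣∣-∷-≤ x X)
Full²⇒≤∣∣ (x ∷ X) zero (suc l₁) (suc s₂) l₂ (s≤s le) f₁ f₂ with ∈ℕ-head (f₁ 0 z≤n (s≤s z≤n))
... | refl = s≤s (Full²⇒≤∣∣ X 0 l₁ s₂ l₂ le (Full-tail₀ f₁) (Full-tail f₂))

x∈p─q⇒x∉q : ∀ {r} (p q : Subset r) {x} → x ∈ p ─ q → x ∉ q
x∈p─q⇒x∉q (_ ∷ p) (inside ∷ q) {Fin.zero} () here
x∈p─q⇒x∉q (_ ∷ p) (_ ∷ q) {Fin.suc x} (there x∈) (there x∈q) = x∈p─q⇒x∉q p q x∈ x∈q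

∈ℕ⇒∈ : ∀ {r m} {a : Fin r} {B : Subset r} → toℕ a ≡ m → m ∈ℕ B → a ∈ B
∈ℕ⇒∈ eq (a' , eq' , p) = subst (_∈ _) (toℕ-injective (trans eq' (sym eq))) p

∪⁻ : ∀ {r m} (A B : Subset r) → m ∈ℕ (A ∪ B) → m ∈ℕ A ⊎ m ∈ℕ B
∪⁻ A B (a , eq , p) with x∈p∪q⁻ A B p
... | inj₁ q = inj₁ (a , eq , q)
... | inj₂ q = inj₂ (a , eq , q)

∪⁺ˡ : ∀ {r m} {A : Subset r} (B : Subset r) → m ∈ℕ A → m ∈ℕ (A ∪ B)
∪⁺ˡ B (a , eq , p) = a , eq , x∈p∪q⁺ (inj₁ p)

∪⁺ʳ : ∀ {r m} (A : Subset r) {B : Subset r} → m ∈ℕ B → m ∈ℕ (A ∪ B)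
∪⁺ʳ A (a , eq , p) = a , eq , x∈p∪q⁺ {p = A} (inj₂ p)

─⁻ : ∀ {r m} (A B : Subset r) → m ∈ℕ (A ─ B) → m ∈ℕ A × ¬ (m ∈ℕ B)
─⁻ A B (a , eq , p) = (a , eq , p─q⊆p A B p) , λ mB → x∈p─q⇒x∉q A B p (∈ℕ⇒∈ eq mB)

─⁺ : ∀ {r m} {A B : Subset r} → m ∈ℕ A → ¬ (m ∈ℕ B) → m ∈ℕ (A ─ B)
─⁺ (a , eq , p) m∉B = a , eq , x∈p∧x∉q⇒x∈p─q p (λ q → m∉B (a , eq , q))

⁅⁆⁻ : ∀ {r m} (i : Fin r) → m ∈ℕ ⁅ i ⁆ → m ≡ toℕ i
⁅⁆⁻ i (a , eq , p) = trans (sym eq) (cong toℕ (x∈⁅y⁆⇒x≡y i p))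

⁅⁆⁺ : ∀ {r} (i : Fin r) → toℕ i ∈ℕ ⁅ i ⁆
⁅⁆⁺ i = i , refl , x∈⁅x⁆ i

-- Boundary sequences

Range : ∀ {r} → (ℕ → Vertex) → ℕ → ℕ → ℕ → Set
Range {r} T lo hi m = Σ ℕ λ j → lo ≤ j × j ≤ hi × In r (T j) m

Consecutive-⇔ : ∀ {P Q : ℕ → Set} → (∀ m → P m → Q m) → (∀ m → Q m → P m) → Consecutive P → Consecutive Q
Consecutive-⇔ f g c a b d x y pa pd = f b (c a b d x y (g a pa) (g d pd))

Consecutive-vertex : ∀ {r v} → IsVertex r v → Consecutive (In r v)
Consecutive-vertex iv m₁ m₂ m₃ a b p₁ p₃ =
  Covers⇒In iv (covers (≤-trans (start≤ (In⇒Covers p₁)) a) (≤-<-trans b (<end (In⇒Covers p₃))))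

Consecutive-empty : ∀ {r T lo hi} → hi < lo → Consecutive (Range {r} T lo hi)
Consecutive-empty lt m₁ m₂ m₃ a b (j₁ , x₁ , y₁ , p₁) _ = ⊥-elim (<⇒≱ lt (≤-trans x₁ y₁))

module BoundarySeq {r : ℕ} {X : Subset r} {p : ℕ} {T : ℕ → Vertex} (bs : IsBoundarySeq r X p T) where

  boundary : ∀ {j} → j < p → Boundary r X (T j)
  boundary {j} lt = proj₁ bs j lt

  vertex : ∀ {j} → j < p → IsVertex r (T j)
  vertex lt = proj₁ (boundary lt)

  complete : ∀ v → Boundary r X v → Σ ℕ λ j → j < p × T j ≡ v
  complete = proj₁ (proj₂ bs)

  left : ∀ {j j' a b} → j < j' → j' < p → Covers (T j) a → Covers (T j') b → a < b
  left {j} {j'} lt lt' xa xb =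
    proj₂ (proj₂ (proj₂ bs) j j' lt lt') _ _ (Covers⇒In (vertex (<-trans lt lt')) xa) (Covers⇒In (vertex lt') xb)

  start-mono : ∀ {j j'} → j ≤ j' → j' < p → start (T j) ≤ start (T j')
  start-mono {j} {j'} le lt with m≤n⇒m<n∨m≡n le
  ... | inj₁ l = <⇒≤ (left l lt (covers-start (T j)) (covers-start (T j')))
  ... | inj₂ refl = ≤-refl

  end≤start : ∀ {j j'} → j < j' → j' < p → end (T j) ≤ start (T j')
  end≤start {j} {j'} lt lt' = subst (_≤ start (T j')) (suc-lastOf (T j))
    (left lt lt' (covers-lastOf (T j)) (covers-start (T j')))

  covered⇒∈ℕ : ∀ {j m} → j < p → Covers (T j) m → m ∈ℕ X
  covered⇒∈ℕ lt x = InSub⇒∈ℕ (vertex lt) (proj₁ (proj₂ (boundary lt))) x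

  cover : ∀ {m} → m ∈ℕ X → Σ ℕ λ j → j < p × Covers (T j) m
  cover m∈X with climb-from-input X m∈X
  ... | b , B , c with complete b B
  ...   | j , lt , refl = j , lt , c

  nonempty : ∀ {m} → m ∈ℕ X → 0 < p
  nonempty m∈X = ≤-<-trans z≤n (proj₁ (proj₂ (cover m∈X)))

  Consecutive-subrange : ∀ {lo hi lo' hi'} → lo ≤ lo' → hi' ≤ hi → hi < p →
    Consecutive (Range {r} T lo hi) → Consecutive (Range {r} T lo' hi')
  Consecutive-subrange {lo} {hi} {lo'} {hi'} l₁ l₂ hp C m₁ m₂ m₃ a b (j₁ , x₁ , y₁ , p₁) (j₃ , x₃ , y₃ , p₃)
    with C m₁ m₂ m₃ a b (j₁ , ≤-trans l₁ x₁ , ≤-trans y₁ l₂ , p₁)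
                        (j₃ , ≤-trans l₁ x₃ , ≤-trans y₃ l₂ , p₃)
  ... | j , x , y , p₂ = j , lo'≤j , j≤hi' , p₂
    where
    lo'≤j : lo' ≤ j
    lo'≤j with lo' ≤? j
    ... | yes q = q
    ... | no q = ⊥-elim (<⇒≱ (left (<-≤-trans (≰⇒> q) x₁) (≤-<-trans (≤-trans y₁ l₂) hp)
                                   (In⇒Covers p₂) (In⇒Covers p₁)) a)
    j≤hi' : j ≤ hi'
    j≤hi' with j ≤? hi'
    ... | yes q = q
    ... | no q = ⊥-elim (<⇒≱ (left (≤-<-trans y₃ (≰⇒> q)) (≤-<-trans y hp) (In⇒Covers p₃) (In⇒Covers p₂)) b)

  Consecutive-single : ∀ {lo} → lo < p → Consecutive (Range {r} T lo lo)
  Consecutive-single {lo} lt m₁ m₂ m₃ a b (j₁ , x₁ , y₁ , p₁) (j₃ , x₃ , y₃ , p₃)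
    with ≤-antisym y₁ x₁ | ≤-antisym y₃ x₃
  ... | refl | refl = lo , ≤-refl , ≤-refl , Consecutive-vertex (vertex lt) m₁ m₂ m₃ a b p₁ p₃

-- Removing K from N and adding x_i

module Extension {r} (N : Subset r) (i : Fin r) (N<i : ∀ a → a ∈ N → toℕ a < toℕ i)
  {p' T'} (bs' : IsBoundarySeq r (N ∪ ⁅ i ⁆) p' T') {J'} (J'<p' : J' < p')
  (cons≤J : Consecutive (λ m → Σ ℕ λ j → j ≤ J' × In r (T' j) m))
  (cons>J : Consecutive (λ m → Σ ℕ λ j → J' < j × j < p' × In r (T' j) m))
  (inc : ∀ j → j < J' → depth (T' j) < depth (T' (suc j)))
  (dec : ∀ j → suc J' ≤ j → suc j < p' → depth (T' (suc j)) < depth (T' j))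
  (K : Subset r) where

  I : ℕ
  I = toℕ i

  N⁺ : Subset r
  N⁺ = N ∪ ⁅ i ⁆

  R : Subset r
  R = (N ─ K) ∪ ⁅ i ⁆

  module B' = BoundarySeq bs'

  N<I : ∀ {m} → m ∈ℕ N → m < I
  N<I (a , refl , a∈N) = N<i a a∈N

  I∉N : ¬ (I ∈ℕ N)
  I∉N I∈N = <-irrefl refl (N<I I∈N)

  N⁺⁻ : ∀ {m} → m ∈ℕ N⁺ → m ∈ℕ N ⊎ m ≡ I
  N⁺⁻ m∈ with ∪⁻ N ⁅ i ⁆ m∈
  ... | inj₁ m∈N = inj₁ m∈N
  ... | inj₂ m∈i = inj₂ (⁅⁆⁻ i m∈i)

  N⁺-≤I : ∀ {m} → m ∈ℕ N⁺ → m ≤ I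
  N⁺-≤I m∈ with N⁺⁻ m∈
  ... | inj₁ m∈N = <⇒≤ (N<I m∈N)
  ... | inj₂ refl = ≤-refl

  N⊆N⁺ : ∀ {m} → m ∈ℕ N → m ∈ℕ N⁺
  N⊆N⁺ = ∪⁺ˡ ⁅ i ⁆

  I∈N⁺ : I ∈ℕ N⁺
  I∈N⁺ = ∪⁺ʳ N (⁅⁆⁺ i)

  R⁻ : ∀ {m} → m ∈ℕ R → (m ∈ℕ N × ¬ (m ∈ℕ K)) ⊎ m ≡ I
  R⁻ m∈ with ∪⁻ (N ─ K) ⁅ i ⁆ m∈
  ... | inj₁ m∈N─K = inj₁ (─⁻ N K m∈N─K)
  ... | inj₂ m∈i = inj₂ (⁅⁆⁻ i m∈i)

  R⊆N⁺ : ∀ {m} → m ∈ℕ R → m ∈ℕ N⁺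
  R⊆N⁺ m∈ with R⁻ m∈
  ... | inj₁ (m∈N , _) = N⊆N⁺ m∈N
  ... | inj₂ refl = I∈N⁺

  ∈R : ∀ {m} → m ∈ℕ N → ¬ (m ∈ℕ K) → m ∈ℕ R
  ∈R m∈N m∉K = ∪⁺ˡ ⁅ i ⁆ (─⁺ m∈N m∉K)

  I∈R : I ∈ℕ R
  I∈R = ∪⁺ʳ (N ─ K) (⁅⁆⁺ i)

  abstract
    L-index : Σ ℕ λ q → q < p' × Covers (T' q) I
    L-index = B'.cover I∈N⁺

  qL : ℕ
  qL = proj₁ L-index

  qL<p' : qL < p'
  qL<p' = proj₁ (proj₂ L-index)

  L : Vertex
  L = T' qL

  I∈L : Covers L I
  I∈L = proj₂ (proj₂ L-index)

  sL : ℕ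
  sL = start L

  hL : ℕ
  hL = depth L

  vL : IsVertex r L
  vL = B'.vertex qL<p'

  ≤qL : ∀ {j} → j < p' → j ≤ qL
  ≤qL {j} lt with j ≤? qL
  ... | yes le = le
  ... | no ≰ = ⊥-elim (<⇒≱ (B'.left (≰⇒> ≰) lt I∈L (covers-start (T' j)))
                           (N⁺-≤I (B'.covered⇒∈ℕ lt (covers-start (T' j)))))

  p'≡1+qL : p' ≡ suc qL
  p'≡1+qL = ≤-antisym (≮⇒≥ λ lt → <-irrefl refl (≤qL lt)) qL<p'

  <qL⇒<p' : ∀ {q} → q < qL → q < p'
  <qL⇒<p' lt = <-trans lt qL<p'

  end-L : sL + 2 ^ hL ≡ suc I
  end-L = ≤-antisym (≮⇒≥ λ lt → <-irrefl refl (≤-<-trans (N⁺-≤I (B'.covered⇒∈ℕ qL<p' (covers I≤ lt))) ≤-refl))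
                    (<end I∈L)
    where
    I≤ : sL ≤ suc I
    I≤ = ≤-trans (start≤ I∈L) (n≤1+n I)

  left-of-L : ∀ {j m} → j < qL → Covers (T' j) m → m < sL
  left-of-L lt x = B'.left lt qL<p' x (covers-start L)

  T⊆N : ∀ {j m} → j < qL → Covers (T' j) m → m ∈ℕ N
  T⊆N {j} {m} lt x with N⁺⁻ (B'.covered⇒∈ℕ (<qL⇒<p' lt) x)
  ... | inj₁ m∈N = m∈N
  ... | inj₂ refl = ⊥-elim (<-irrefl refl (<-≤-trans (left-of-L lt x) (start≤ I∈L)))

  L⊆N : ∀ {m} → Covers L m → m < I → m ∈ℕ N
  L⊆N {m} x lt with N⁺⁻ (B'.covered⇒∈ℕ qL<p' x)
  ... | inj₁ m∈N = m∈N
  ... | inj₂ refl = ⊥-elim (<-irrefl refl lt)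

  Boundary-N-T : ∀ {j} → j < qL → Boundary r N (T' j)
  Boundary-N-T lt = Boundary-⊆ N⊆N⁺ (B'.boundary (<qL⇒<p' lt)) (∈ℕ⇒InSub λ m x → T⊆N lt x)

  -- The boundary trees of N inside L are the left children of the vertices on
  -- the path from x_I up to L: their parents end exactly after x_I.
  SpineChild : Vertex → Set
  SpineChild S = depth S < hL × start S + 2 ^ suc (depth S) ≡ suc I × S ⊑ L

  Boundary-N⊑L⇒SpineChild : ∀ {S} → Boundary r N S → S ⊑ L → SpineChild S
  Boundary-N⊑L⇒SpineChild {S} (vS , isS , maxS) S⊑L = dS<hL , parent-ends-at-I , S⊑L
    where
    I∉S : ¬ Covers S I
    I∉S x = I∉N (InSub⇒∈ℕ vS isS x)
    dS<hL : depth S < hL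
    dS<hL with depth S <? hL
    ... | yes lt = lt
    ... | no ≮ = ⊥-elim (I∉S (⊑-covers (laminar vL vS (≮⇒≥ ≮) (⊑-covers S⊑L (covers-start S)) (covers-start S)) I∈L))
    parent-ends-at-I : start S + 2 ^ suc (depth S) ≡ suc I
    parent-ends-at-I with parent-within vS vL dS<hL S⊑L
    ... | w , e@(_ , vw , refl , rel) , w⊑L with Covers? w I
    ...   | no I∉w = ⊥-elim (maxS w e (∈ℕ⇒InSub λ m x → L⊆N (⊑-covers w⊑L x)
                 (≤∧≢⇒< (N⁺-≤I (B'.covered⇒∈ℕ qL<p' (⊑-covers w⊑L x))) λ { refl → I∉w x })))
    ...   | yes I∈w = left-child rel
      where
      end-w : end w ≡ suc I
      end-w = ≤-antisym (subst (end w ≤_) end-L (⊑-end w⊑L)) (<end I∈w)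
      left-child : (start S ≡ start w ⊎ start S ≡ start w + 2 ^ depth S) → start S + 2 ^ suc (depth S) ≡ suc I
      left-child (inj₁ eq) = trans (cong (_+ 2 ^ suc (depth S)) eq) end-w
      left-child (inj₂ eq) = ⊥-elim (I∉S (covers (<⇒≤ (N<I (InSub⇒∈ℕ vS isS (covers-start S))))
                                                 (subst (I <_) end-w≡end-S (<end I∈w))))
        where
        end-w≡end-S : start w + 2 ^ suc (depth S) ≡ start S + 2 ^ depth S
        end-w≡end-S = begin
          start w + 2 ^ suc (depth S)           ≡⟨ cong (start w +_) (2^-suc (depth S)) ⟩
          start w + (2 ^ depth S + 2 ^ depth S) ≡⟨ +-assoc (start w) _ _ ⟨
          start w + 2 ^ depth S + 2 ^ depth S   ≡⟨ cong (_+ 2 ^ depth S) eq ⟨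
          start S + 2 ^ depth S                 ∎
          where open ≡-Reasoning

  Boundary-N-classify : ∀ {S} → Boundary r N S → (Σ ℕ λ q → q < qL × S ≡ T' q) ⊎ SpineChild S
  Boundary-N-classify {S} BS@(vS , isS , _) with climb-to-boundary N⁺ r S (m≤n+m r _) vS (InSub-mono N⊆N⁺ isS)
  ... | b , Bb , S⊑b with B'.complete b Bb
  ...   | q , q<p' , refl with m≤n⇒m<n∨m≡n (≤qL q<p')
  ...     | inj₁ q<qL = inj₁ (q , q<qL , Boundary-unique BS (Boundary-N-T q<qL) (covers-start S) (⊑-covers S⊑b (covers-start S)))
  ...     | inj₂ refl = inj₂ (Boundary-N⊑L⇒SpineChild BS S⊑b)

  K⊆[_⋯_] : ℕ → ℕ → Set
  K⊆[ x ⋯ y ] = ∀ {m} → m ∈ℕ K → m ∈ℕ N × x ≤ m × m ≤ y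

  N∩[_⋯_]⊆K : ℕ → ℕ → Set
  N∩[ x ⋯ y ]⊆K = ∀ {m} → m ∈ℕ N → x ≤ m → m ≤ y → m ∈ℕ K

  -- K is the part of N from the first input of T' a up to x_y.  It begins with
  -- the Δ trees T' a … T' (a + Δ - 1); nU trees T' (a + Δ) … T' (qL - 1) survive,
  -- and the last boundary tree of the remainder is M = (sM , t), ending at x_I.
  -- Either (E, first case) K ends with T' (a + Δ - 1) and M = L, or (second case)
  -- K ends with a spine child of L of depth t, nU = 0, and M is its sibling.
  record Cut : Set where
    field
      a Δ nU t y sM : ℕ
      qL≡ : qL ≡ a + Δ + nU
      a≤J : a ≤ suc J'
      cJ : 0 < nU → suc J' ≤ a + Δ
      t≤hL : t ≤ hL
      sM≡ : sM + 2 ^ t ≡ suc I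
      E : (Σ ℕ λ Δ' → Δ ≡ suc Δ' × t ≡ hL × suc y ≡ end (T' (a + Δ'))) ⊎ (t < hL × nU ≡ 0 × y + 2 ^ t ≡ I)
      K⊆[x⋯y] : K⊆[ start (T' a) ⋯ y ]
      N∩[x⋯y]⊆K : N∩[ start (T' a) ⋯ y ]⊆K

  module Remainder (cut : Cut) where
    open Cut cut

    c : ℕ
    c = a + Δ

    x : ℕ
    x = start (T' a)

    M : Vertex
    M = (sM , t)

    pU : ℕ
    pU = suc (a + nU)

    a≤qL : a ≤ qL
    a≤qL = subst (a ≤_) (sym qL≡) (≤-trans (m≤m+n a Δ) (m≤m+n (a + Δ) nU))

    c≤qL : c ≤ qL
    c≤qL = subst (c ≤_) (sym qL≡) (m≤m+n c nU)

    a<p' : a < p'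
    a<p' = subst (a <_) (sym p'≡1+qL) (s≤s a≤qL)

    sM≡' : sM + 2 ^ t ≡ sL + 2 ^ hL
    sM≡' = trans sM≡ (sym end-L)

    sL≤sM : sL ≤ sM
    sL≤sM = +-cancelʳ-≤ (2 ^ hL) sL sM (subst (_≤ sM + 2 ^ hL) sM≡' (+-monoʳ-≤ sM (2^-mono-≤ t≤hL)))

    sM≤I : sM ≤ I
    sM≤I = s≤s⁻¹ (subst (suc sM ≤_) sM≡ (subst (_≤ sM + 2 ^ t) (+-comm sM 1) (+-monoʳ-≤ sM (2^>0 t))))

    M⊑L : M ⊑ L
    M⊑L = nested sL≤sM (≤-reflexive sM≡')

    vM : IsVertex r M
    vM = IsVertex-sub vL t≤hL sL≤sM (≤-reflexive sM≡') (Aligned-pred {h = t} sM+2^t-aligned sL≤sM)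
      where
      sM+2^t-aligned : Aligned (2 ^ t) sL (sM + 2 ^ t)
      sM+2^t-aligned = subst (Aligned (2 ^ t) sL) (sym sM≡')
        (Aligned-weaken {A = 2 ^ hL} (2^-∣ t≤hL) (Aligned-+ {b = sL} (Aligned-refl {b = sL})))

    E1⇒M≡L : ∀ {Δ'} → Δ ≡ suc Δ' × t ≡ hL × suc y ≡ end (T' (a + Δ')) → M ≡ L
    E1⇒M≡L (_ , refl , _) = vertex-≡ (+-cancelʳ-≡ (2 ^ hL) sM sL sM≡') refl

    E2⇒sM≡1+y : y + 2 ^ t ≡ I → sM ≡ suc y
    E2⇒sM≡1+y eq = +-cancelʳ-≡ (2 ^ t) sM (suc y) (trans sM≡ (cong suc (sym eq)))

    E2⇒sL≤y : t < hL → y + 2 ^ t ≡ I → sL ≤ y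
    E2⇒sL≤y t<hL eq = +-cancelʳ-≤ (2 ^ t) sL y
      (s≤s⁻¹ (subst₂ _≤_ (+-suc sL (2 ^ t)) (trans end-L (cong suc (sym eq))) (+-monoʳ-≤ sL (2^-mono-< t<hL))))

    y<sM : y < sM
    y<sM with E
    ... | inj₁ (Δ' , refl , refl , eq) = subst (y <_) (sym (+-cancelʳ-≡ (2 ^ hL) sM sL sM≡'))
           (left-of-L (subst (a + Δ' <_) (sym qL≡) (<-≤-trans (+-monoʳ-< a (n<1+n Δ')) (m≤m+n (a + suc Δ') nU)))
                      (covers-pred-end (T' (a + Δ')) eq))
    ... | inj₂ (_ , _ , eq) = ≤-reflexive (sym (E2⇒sM≡1+y eq))

    x≤sL : x ≤ sL
    x≤sL = B'.start-mono a≤qL qL<p'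

    T-outside-cut-∉K : ∀ {q} → q < qL → (q < a ⊎ c ≤ q) → ∀ {m} → Covers (T' q) m → ¬ (m ∈ℕ K)
    T-outside-cut-∉K {q} q<qL off-cut {m} xm mK with K⊆[x⋯y] mK | off-cut
    ... | _ , x≤m , _ | inj₁ q<a = <⇒≱ (B'.left q<a a<p' xm (covers-start (T' a))) x≤m
    ... | _ , _ , m≤y | inj₂ c≤q with E
    ...   | inj₁ (Δ' , refl , _ , eq) =
      <⇒≱ (B'.left (<-≤-trans (+-monoʳ-< a (n<1+n Δ')) c≤q) (<qL⇒<p' q<qL) (covers-pred-end (T' (a + Δ')) eq) xm) m≤y
    ...   | inj₂ (_ , nU≡0 , _) =
      <⇒≱ q<qL (subst (_≤ q) (trans (trans (sym (+-identityʳ c)) (cong (c +_) (sym nU≡0))) (sym qL≡)) c≤q)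

    Boundary-R-T : ∀ {q} → q < qL → (q < a ⊎ c ≤ q) → Boundary r R (T' q)
    Boundary-R-T q<qL off-cut = Boundary-⊆ R⊆N⁺ (B'.boundary (<qL⇒<p' q<qL))
      (∈ℕ⇒InSub λ m xm → ∈R (T⊆N q<qL xm) (T-outside-cut-∉K q<qL off-cut xm))

    M⊆R : ∀ {m} → Covers M m → m ∈ℕ R
    M⊆R {m} xm with m≤n⇒m<n∨m≡n (m<n+1⇒m≤n (subst (m <_) (trans sM≡ (+-comm 1 I)) (<end xm)))
    ... | inj₂ refl = I∈R
    ... | inj₁ m<I = ∈R (L⊆N (⊑-covers M⊑L xm) m<I)
                        λ m∈K → <⇒≱ (<-≤-trans y<sM (start≤ xm)) (proj₂ (proj₂ (K⊆[x⋯y] m∈K)))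

    -- When M is a proper subtree of L, its parent covers x_y ∈ K (if M is a
    -- right child) or x_(I+1) ∉ N⁺ (if M is a left child).
    Boundary-R-M : Boundary r R M
    Boundary-R-M with E
    ... | inj₁ e1 = Boundary-⊆ R⊆N⁺ (subst (Boundary r N⁺) (sym (E1⇒M≡L (proj₂ e1))) (B'.boundary qL<p'))
                      (∈ℕ⇒InSub λ m → M⊆R)
    ... | inj₂ (t<hL , _ , eq) = vM , ∈ℕ⇒InSub (λ m → M⊆R) , maximal
      where
      maximal : ∀ w → Edge r M w → ¬ InSub r w R
      maximal (sw , .(suc t)) (_ , vw , refl , inj₁ refl) isw =
        <-irrefl refl (N⁺-≤I (R⊆N⁺ (InSub⇒∈ℕ vw isw (covers (<⇒≤ (s≤s sM≤I)) lt))))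
        where
        lt : suc I < sM + 2 ^ suc t
        lt = subst₂ _<_ sM≡ (trans (+-assoc sM _ _) (cong (sM +_) (sym (2^-suc t)))) (m<m+n (sM + 2 ^ t) (2^>0 t))
      maximal (sw , .(suc t)) (_ , vw , refl , inj₂ eqw) isw with R⁻ (InSub⇒∈ℕ vw isw yw)
        where
        sy : sw + 2 ^ t ≡ suc y
        sy = trans (sym eqw) (E2⇒sM≡1+y eq)
        yw : Covers (sw , suc t) y
        yw = covers (s≤s⁻¹ (subst (suc sw ≤_) sy (subst (_≤ sw + 2 ^ t) (+-comm sw 1) (+-monoʳ-≤ sw (2^>0 t)))))
                    (<-≤-trans (subst (y <_) (sym sy) ≤-refl) (+-monoʳ-≤ sw (2^-mono-≤ (n≤1+n t))))
      ... | inj₁ (y∈N , y∉K) = y∉K (N∩[x⋯y]⊆K y∈N (≤-trans x≤sL (E2⇒sL≤y t<hL eq)) ≤-refl)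
      ... | inj₂ y≡I = <-irrefl y≡I (subst (y <_) eq (m<m+n y (2^>0 t)))

    skip : ℕ → ℕ
    skip j with j <? a
    ... | yes _ = j
    ... | no _ = j + Δ

    U : ℕ → Vertex
    U j with skip j <? qL
    ... | yes _ = T' (skip j)
    ... | no _ = M

    skip-below : ∀ {j} → j < a → skip j ≡ j
    skip-below {j} lt with j <? a
    ... | yes _ = refl
    ... | no ≮ = ⊥-elim (≮ lt)

    skip-above : ∀ {j} → a ≤ j → skip j ≡ j + Δ
    skip-above {j} le with j <? a
    ... | yes lt = ⊥-elim (<⇒≱ lt le)
    ... | no _ = refl

    U-T : ∀ {j} → skip j < qL → U j ≡ T' (skip j)
    U-T {j} lt with skip j <? qL
    ... | yes _ = refl
    ... | no ≮ = ⊥-elim (≮ lt)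

    U-M : ∀ {j} → qL ≤ skip j → U j ≡ M
    U-M {j} le with skip j <? qL
    ... | yes lt = ⊥-elim (<⇒≱ lt le)
    ... | no _ = refl

    qL≡' : qL ≡ a + nU + Δ
    qL≡' = trans qL≡ (trans (+-assoc a Δ nU) (trans (cong (a +_) (+-comm Δ nU)) (sym (+-assoc a nU Δ))))

    skip-avoids-cut : ∀ j → skip j < a ⊎ c ≤ skip j
    skip-avoids-cut j = by-side (j <? a)
      where
      by-side : Dec (j < a) → skip j < a ⊎ c ≤ skip j
      by-side (yes lt) = inj₁ (subst (_< a) (sym (skip-below lt)) lt)
      by-side (no ≮) = inj₂ (subst (c ≤_) (sym (skip-above (≮⇒≥ ≮))) (+-monoˡ-≤ Δ (≮⇒≥ ≮)))

    skip-mono : ∀ {j j'} → j < j' → skip j < skip j'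
    skip-mono {j} {j'} lt = by-side (j <? a) (j' <? a)
      where
      by-side : Dec (j < a) → Dec (j' < a) → skip j < skip j'
      by-side (yes p) (yes p') = subst₂ _<_ (sym (skip-below p)) (sym (skip-below p')) lt
      by-side (yes p) (no p') = subst₂ _<_ (sym (skip-below p)) (sym (skip-above (≮⇒≥ p'))) (<-≤-trans lt (m≤m+n j' Δ))
      by-side (no p) (yes p') = ⊥-elim (p (<-trans lt p'))
      by-side (no p) (no p') = subst₂ _<_ (sym (skip-above (≮⇒≥ p))) (sym (skip-above (≮⇒≥ p'))) (+-monoˡ-< Δ lt)

    skip-<qL : ∀ {j} → j < a + nU → skip j < qL
    skip-<qL {j} lt = by-side (j <? a)
      where
      by-side : Dec (j < a) → skip j < qL
      by-side (yes p) = subst (_< qL) (sym (skip-below p)) (<-≤-trans p a≤qL)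
      by-side (no p) = subst₂ _<_ (sym (skip-above (≮⇒≥ p))) (sym qL≡') (+-monoˡ-< Δ lt)

    skip-last : skip (a + nU) ≡ qL
    skip-last = trans (skip-above (m≤m+n a nU)) (sym qL≡')

    U-last : U (a + nU) ≡ M
    U-last = U-M (≤-reflexive (sym skip-last))

    U-cases : ∀ {j} → j < pU → (skip j < qL × U j ≡ T' (skip j)) ⊎ (j ≡ a + nU × U j ≡ M)
    U-cases {j} lt with m≤n⇒m<n∨m≡n (s≤s⁻¹ lt)
    ... | inj₁ l = inj₁ (skip-<qL l , U-T (skip-<qL l))
    ... | inj₂ refl = inj₂ (refl , U-last)

    U-boundary : ∀ {j} → j < pU → Boundary r R (U j)
    U-boundary {j} lt with U-cases lt
    ... | inj₁ (l , eq) = subst (Boundary r R) (sym eq) (Boundary-R-T l (skip-avoids-cut j))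
    ... | inj₂ (_ , eq) = subst (Boundary r R) (sym eq) Boundary-R-M

    U-vertex : ∀ {j} → j < pU → IsVertex r (U j)
    U-vertex lt = proj₁ (U-boundary lt)

    U-left : ∀ {j j' m m'} → j < j' → j' < pU → Covers (U j) m → Covers (U j') m' → m < m'
    U-left {j} {j'} lt lt' xm xm' with U-cases lt' | U-cases (<-trans lt lt')
    ... | inj₁ (l' , e') | inj₁ (l , e) =
      B'.left (skip-mono lt) (<qL⇒<p' l') (subst (λ v → Covers v _) e xm) (subst (λ v → Covers v _) e' xm')
    ... | inj₁ (l' , e') | inj₂ (refl , _) = ⊥-elim (<⇒≱ lt (s≤s⁻¹ lt'))
    ... | inj₂ (refl , e') | inj₁ (l , e) =
      <-≤-trans (left-of-L l (subst (λ v → Covers v _) e xm)) (≤-trans sL≤sM (start≤ (subst (λ v → Covers v _) e' xm')))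
    ... | inj₂ (refl , _) | inj₂ (refl , _) = ⊥-elim (<-irrefl refl lt)

    U-LeftOf : ∀ j j' → j < j' → j' < pU → LeftOf r (U j) (U j')
    U-LeftOf j j' lt lt' = (λ m (p , q) → <-irrefl refl (U-left lt lt' (In⇒Covers p) (In⇒Covers q))) ,
                           λ m m' p q → U-left lt lt' (In⇒Covers p) (In⇒Covers q)

    T-in-U : ∀ {q} → q < qL → (q < a ⊎ c ≤ q) → Σ ℕ λ j → j < pU × U j ≡ T' q
    T-in-U {q} q<qL (inj₁ q<a) = q , s≤s (≤-trans (<⇒≤ q<a) (m≤m+n a nU)) ,
      trans (U-T (subst (_< qL) (sym (skip-below q<a)) q<qL)) (cong T' (skip-below q<a))
    T-in-U {q} q<qL (inj₂ c≤q) with m≤n⇒∃[o]m+o≡n c≤q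
    ... | k , refl = a + k , s≤s (<⇒≤ (+-monoʳ-< a k<nU)) , trans (U-T skip<qL) (cong T' skip≡)
      where
      skip≡ : skip (a + k) ≡ c + k
      skip≡ = trans (skip-above (m≤m+n a k)) (trans (+-assoc a k Δ) (trans (cong (a +_) (+-comm k Δ)) (sym (+-assoc a Δ k))))
      skip<qL : skip (a + k) < qL
      skip<qL = subst (_< qL) (sym skip≡) q<qL
      k<nU : k < nU
      k<nU = +-cancelˡ-< c k nU (subst (c + k <_) qL≡ q<qL)

    before-cut-end⇒≤y : ∀ {q m} → q < qL → q < c → Covers (T' q) m → m ≤ y
    before-cut-end⇒≤y {q} {m} q<qL q<c xm with E
    ... | inj₁ (Δ' , refl , _ , eq) with m≤n⇒m<n∨m≡n (s≤s⁻¹ (subst (suc q ≤_) (+-suc a Δ') q<c))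
    ...   | inj₁ lt = <⇒≤ (B'.left lt (<qL⇒<p' (<-≤-trans (subst (a + Δ' <_) (sym (+-suc a Δ')) ≤-refl) c≤qL)) xm
                                (covers-pred-end (T' (a + Δ')) eq))
    ...   | inj₂ refl = s≤s⁻¹ (subst (m <_) (sym eq) (<end xm))
    before-cut-end⇒≤y q<qL q<c xm | inj₂ (t<hL , _ , eq) = ≤-trans (<⇒≤ (left-of-L q<qL xm)) (E2⇒sL≤y t<hL eq)

    R∩T⇒outside-cut : ∀ {q m} → q < qL → Covers (T' q) m → m ∈ℕ R → q < a ⊎ c ≤ q
    R∩T⇒outside-cut {q} q<qL xm m∈R with q <? a | c ≤? q
    ... | yes q<a | _ = inj₁ q<a
    ... | no _ | yes c≤q = inj₂ c≤q
    ... | no q≮a | no c≰q with R⁻ m∈R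
    ...   | inj₂ refl = ⊥-elim (<-irrefl refl (<-≤-trans (left-of-L q<qL xm) (start≤ I∈L)))
    ...   | inj₁ (m∈N , m∉K) = ⊥-elim (m∉K (N∩[x⋯y]⊆K m∈N
              (≤-trans (B'.start-mono (≮⇒≥ q≮a) (<qL⇒<p' q<qL)) (start≤ xm)) (before-cut-end⇒≤y q<qL (≰⇒> c≰q) xm)))

    Boundary-R⊑L⇒≡M : ∀ {v} → Boundary r R v → v ⊑ L → v ≡ M
    Boundary-R⊑L⇒≡M {v} Bv@(vv , isv , _) v⊑L =
      Boundary-unique Bv Boundary-R-M (covers-start v) (covers sM≤v v<endM)
      where
      v∈R : start v ∈ℕ R
      v∈R = InSub⇒∈ℕ vv isv (covers-start v)
      v<endM : start v < sM + 2 ^ t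
      v<endM = subst (start v <_) (sym sM≡) (s≤s (N⁺-≤I (R⊆N⁺ v∈R)))
      sM≤v : sM ≤ start v
      sM≤v with E
      ... | inj₁ e1 = subst (λ z → start z ≤ start v) (sym (E1⇒M≡L (proj₂ e1))) (⊑-start v⊑L)
      ... | inj₂ (t<hL , _ , eq) with sM ≤? start v
      ...   | yes le = le
      ...   | no ≰ with R⁻ v∈R
      ...     | inj₂ v≡I = ⊥-elim (<⇒≱ (≰⇒> ≰) (subst (sM ≤_) (sym v≡I) sM≤I))
      ...     | inj₁ (v∈N , v∉K) = ⊥-elim (v∉K (N∩[x⋯y]⊆K v∈N (≤-trans x≤sL (⊑-start v⊑L))
                                      (s≤s⁻¹ (subst (start v <_) (E2⇒sM≡1+y eq) (≰⇒> ≰)))))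

    Boundary-R⊑T⇒∈U : ∀ {v q} → Boundary r R v → q < qL → v ⊑ T' q → Σ ℕ λ j → j < pU × U j ≡ v
    Boundary-R⊑T⇒∈U {v} {q} Bv@(vv , isv , _) q<qL v⊑T =
      let (j , j<pU , Uj≡) = T-in-U q<qL off-cut
      in j , j<pU , trans Uj≡ (sym (Boundary-unique Bv (Boundary-R-T q<qL off-cut) (covers-start v) v∈T))
      where
      v∈T : Covers (T' q) (start v)
      v∈T = ⊑-covers v⊑T (covers-start v)
      off-cut : q < a ⊎ c ≤ q
      off-cut = R∩T⇒outside-cut q<qL v∈T (InSub⇒∈ℕ vv isv (covers-start v))

    U-complete : ∀ v → Boundary r R v → Σ ℕ λ j → j < pU × U j ≡ v
    U-complete v Bv@(vv , isv , _) with climb-to-boundary N⁺ r v (m≤n+m r _) vv (InSub-mono R⊆N⁺ isv)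
    ... | b , Bb , v⊑b with B'.complete b Bb
    ...   | q , q<p' , refl with m≤n⇒m<n∨m≡n (≤qL q<p')
    ...     | inj₂ refl = a + nU , ≤-refl , trans U-last (sym (Boundary-R⊑L⇒≡M Bv v⊑b))
    ...     | inj₁ q<qL = Boundary-R⊑T⇒∈U Bv q<qL v⊑b

    U-boundary-seq : IsBoundarySeq r R pU U
    U-boundary-seq = (λ j lt → U-boundary lt) , U-complete , U-LeftOf

    U-below-a : ∀ {j} → j < a → U j ≡ T' j
    U-below-a {j} lt = trans (U-T (subst (_< qL) (sym (skip-below lt)) (<-≤-trans lt a≤qL))) (cong T' (skip-below lt))

    U-whole-trees : ∀ {Δ'} → Δ ≡ suc Δ' × t ≡ hL × suc y ≡ end (T' (a + Δ')) → ∀ {j} → j < pU → U j ≡ T' (skip j)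
    U-whole-trees e1 {j} lt with U-cases lt
    ... | inj₁ (_ , eq) = eq
    ... | inj₂ (refl , eq) = trans eq (trans (E1⇒M≡L e1) (cong T' (sym skip-last)))

    cons≤J' : Consecutive (Range {r} T' 0 J')
    cons≤J' = Consecutive-⇔ (λ { m (j , le , p) → j , z≤n , le , p }) (λ { m (j , _ , le , p) → j , le , p }) cons≤J

    cons>J' : Consecutive (Range {r} T' (suc J') qL)
    cons>J' = Consecutive-⇔ (λ { m (j , x , y , p) → j , x , s≤s⁻¹ (subst (j <_) p'≡1+qL y) , p })
                            (λ { m (j , x , y , p) → j , x , subst (j <_) (sym p'≡1+qL) (s≤s y) , p }) cons>J

    U-consecutive-≤peak : Consecutive (λ m → Σ ℕ λ j → j ≤ a ∸ 1 × In r (U j) m)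
    U-consecutive-≤peak with a ≟ 0
    ... | yes a≡0 = Consecutive-⇔ (λ m p → 0 , z≤n , p)
        (λ { m (j , le , p) → subst (λ z → In r (U z) m) (n≤0⇒n≡0 (subst (λ z → j ≤ z ∸ 1) a≡0 le)) p })
        (Consecutive-vertex (U-vertex (s≤s z≤n)))
    ... | no a≢0 = Consecutive-⇔ (λ { m (j , _ , le , p) → j , le , subst (λ v → In r v m) (sym (U-below-a (lt' le))) p })
                                 (λ { m (j , le , p) → j , z≤n , le , subst (λ v → In r v m) (U-below-a (lt' le)) p })
                                 (B'.Consecutive-subrange z≤n (∸-monoˡ-≤ 1 a≤J) J'<p' cons≤J')
      where
      lt' : ∀ {j} → j ≤ a ∸ 1 → j < a
      lt' {j} le = <-≤-trans (s≤s le) (≤-reflexive (suc-pred a {{≢-nonZero a≢0}}))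

    a₊ : ℕ
    a₊ = suc (a ∸ 1)

    a≤a₊ : a ≤ a₊
    a≤a₊ with a
    ... | zero = z≤n
    ... | suc _ = ≤-refl

    U-consecutive->peak-spine : nU ≡ 0 → Consecutive (λ m → Σ ℕ λ j → a ∸ 1 < j × j < pU × In r (U j) m)
    U-consecutive->peak-spine nU≡0 with a ≟ 0
    ... | yes a≡0 = λ { m₁ m₂ m₃ _ _ (j , x , y , p) _ → ⊥-elim (<⇒≱ y
            (subst (λ z → suc (z + nU) ≤ j) (sym a≡0) (subst (λ z → suc z ≤ j) (sym nU≡0) (subst (λ z → z ∸ 1 < j) a≡0 x)))) }
    ... | no a≢0 = Consecutive-⇔
        (λ m p → a + nU , <-≤-trans (≤-reflexive a₊≡a) (m≤m+n a nU) , ≤-refl , subst (λ v → In r v m) (sym U-last) p)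
        (λ { m (j , x , y , p) → subst (λ v → In r v m) (U-M (≤-reflexive (sym (trans (cong skip (j≡ x y)) skip-last)))) p })
        (Consecutive-vertex vM)
      where
      a₊≡a : a₊ ≡ a
      a₊≡a = suc-pred a {{≢-nonZero a≢0}}
      j≡ : ∀ {j} → a ∸ 1 < j → j < pU → j ≡ a + nU
      j≡ {j} x y = ≤-antisym (s≤s⁻¹ y) (subst (_≤ j) (sym (trans (cong (a +_) nU≡0) (+-identityʳ a))) (subst (_≤ j) a₊≡a x))

    T-after-cut-consecutive : Consecutive (Range {r} T' (a₊ + Δ) qL)
    T-after-cut-consecutive with nU ≟ 0
    ... | no nU≢0 = B'.Consecutive-subrange (≤-trans (cJ (n≢0⇒n>0 nU≢0)) (+-monoˡ-≤ Δ a≤a₊)) ≤-refl qL<p' cons>J'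
    ... | yes nU≡0 with m≤n⇒m<n∨m≡n a≤a₊
    ...   | inj₁ lt = Consecutive-empty (subst (_< a₊ + Δ) (sym qL≡c) (+-monoˡ-< Δ lt))
      where
      qL≡c : qL ≡ c
      qL≡c = trans qL≡ (trans (cong (c +_) nU≡0) (+-identityʳ _))
    ...   | inj₂ eq = subst (λ z → Consecutive (Range {r} T' z qL)) (trans qL≡c (cong (_+ Δ) eq)) (B'.Consecutive-single qL<p')
      where
      qL≡c : qL ≡ c
      qL≡c = trans qL≡ (trans (cong (c +_) nU≡0) (+-identityʳ _))

    U-consecutive->peak-whole-trees : ∀ {Δ'} → Δ ≡ suc Δ' × t ≡ hL × suc y ≡ end (T' (a + Δ')) →
      Consecutive (λ m → Σ ℕ λ j → a ∸ 1 < j × j < pU × In r (U j) m)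
    U-consecutive->peak-whole-trees e1 = Consecutive-⇔ to from T-after-cut-consecutive
      where
      shift : ∀ k → a₊ + k + Δ ≡ a₊ + Δ + k
      shift k = trans (+-assoc a₊ k Δ) (trans (cong (a₊ +_) (+-comm k Δ)) (sym (+-assoc a₊ Δ k)))
      to : ∀ m → Range {r} T' (a₊ + Δ) qL m → Σ ℕ λ j → a ∸ 1 < j × j < pU × In r (U j) m
      to m (q , lo , hi , p) with m≤n⇒∃[o]m+o≡n lo
      ... | k , refl = a₊ + k , m≤m+n a₊ k , s≤s j≤ ,
                       subst (λ v → In r v m) (sym (trans (U-whole-trees e1 (s≤s j≤)) (cong T' skip≡))) p
        where
        skip≡ : skip (a₊ + k) ≡ a₊ + Δ + k
        skip≡ = trans (skip-above (≤-trans a≤a₊ (m≤m+n a₊ k))) (shift k)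
        j≤ : a₊ + k ≤ a + nU
        j≤ = +-cancelʳ-≤ Δ _ _ (subst₂ _≤_ (sym (shift k)) qL≡' hi)
      from : ∀ m → (Σ ℕ λ j → a ∸ 1 < j × j < pU × In r (U j) m) → Range {r} T' (a₊ + Δ) qL m
      from m (j , x , y , p) = j + Δ , +-monoˡ-≤ Δ x , subst (j + Δ ≤_) (sym qL≡') (+-monoˡ-≤ Δ (s≤s⁻¹ y)) ,
        subst (λ v → In r v m) (trans (U-whole-trees e1 y) (cong T' (skip-above (≤-trans a≤a₊ x)))) p

    U-consecutive->peak : Consecutive (λ m → Σ ℕ λ j → a ∸ 1 < j × j < pU × In r (U j) m)
    U-consecutive->peak with E
    ... | inj₁ (_ , e1) = U-consecutive->peak-whole-trees e1
    ... | inj₂ (_ , nU≡0 , _) = U-consecutive->peak-spine nU≡0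

    U-increasing : ∀ j → j < a ∸ 1 → depth (U j) < depth (U (suc j))
    U-increasing j lt = subst₂ (λ u v → depth u < depth v) (sym (U-below-a (<-trans (n<1+n j) 1+j<a))) (sym (U-below-a 1+j<a))
                          (inc j (s≤s⁻¹ (<-≤-trans 1+j<a a≤J)))
      where
      <∸1⇒1+<  : ∀ a₀ → j < a₀ ∸ 1 → suc j < a₀
      <∸1⇒1+< (suc _) l = s≤s l
      1+j<a : suc j < a
      1+j<a = <∸1⇒1+< a lt

    U-decreasing : ∀ j → suc (a ∸ 1) ≤ j → suc j < pU → depth (U (suc j)) < depth (U j)
    U-decreasing j x y with E
    ... | inj₂ (_ , nU≡0 , _) = ⊥-elim (<⇒≱ (subst (j <_) (trans (cong (a +_) nU≡0) (+-identityʳ a)) (s≤s⁻¹ y)) (≤-trans a≤a₊ x))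
    ... | inj₁ (Δ' , e1) =
      subst₂ (λ u v → depth u < depth v)
        (sym (trans (U-whole-trees e1 y) (cong T' (skip-above (≤-trans a≤j (n≤1+n j))))))
        (sym (trans (U-whole-trees e1 (<-trans (n<1+n j) y)) (cong T' (skip-above a≤j))))
        (dec (j + Δ) (≤-trans (cJ nU>0) (+-monoˡ-≤ Δ a≤j))
             (subst (suc (j + Δ) <_) (sym p'≡1+qL) (s≤s (subst (suc j + Δ ≤_) (sym qL≡') (+-monoˡ-≤ Δ (s≤s⁻¹ y))))))
      where
      a≤j : a ≤ j
      a≤j = ≤-trans a≤a₊ x
      nU>0 : 0 < nU
      nU>0 with nU ≟ 0
      ... | no nU≢0 = n≢0⇒n>0 nU≢0
      ... | yes nU≡0 = ⊥-elim (<⇒≱ (subst (j <_) (trans (cong (a +_) nU≡0) (+-identityʳ a)) (s≤s⁻¹ y)) a≤j)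

    remainder-triangular : Triangular r R
    remainder-triangular = pU , U , U-boundary-seq ,
      inj₂ (a ∸ 1 , s≤s (≤-trans (m∸n≤m a 1) (m≤m+n a nU)) ,
            U-consecutive-≤peak , U-consecutive->peak , U-increasing , U-decreasing)

  lenL : ℕ
  lenL = pred (2 ^ hL)

  suc-lenL : suc lenL ≡ 2 ^ hL
  suc-lenL = suc-pred (2 ^ hL) {{m^n≢0 2 hL}}

  sL+lenL : sL + lenL ≡ I
  sL+lenL = suc-injective (trans (sym (+-suc sL lenL)) (trans (cong (sL +_) suc-lenL) end-L))

  Full-L : Full N sL lenL
  Full-L m a b = L⊆N (covers a (<-trans m<I (subst (I <_) (sym end-L) ≤-refl))) m<I
    where
    m<I : m < I
    m<I = subst (m <_) sL+lenL b

  Full-T : ∀ {q} → q < qL → Full N (start (T' q)) (2 ^ depth (T' q))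
  Full-T lt m a b = T⊆N lt (covers a b)

  depth-increasing : ∀ {q₀ q₁} → q₀ < q₁ → q₁ ≤ J' → depth (T' q₀) < depth (T' q₁)
  depth-increasing {q₀} {suc q} lt le with m≤n⇒m<n∨m≡n (s≤s⁻¹ lt)
  ... | inj₁ l = <-trans (depth-increasing l (≤-trans (n≤1+n q) le)) (inc q le)
  ... | inj₂ refl = inc q le

  depth-decreasing : ∀ {q₀ q₁} → suc J' ≤ q₀ → q₀ < q₁ → q₁ < p' → depth (T' q₁) < depth (T' q₀)
  depth-decreasing {q₀} {suc q} le lt lt' with m≤n⇒m<n∨m≡n (s≤s⁻¹ lt)
  ... | inj₁ l = <-trans (dec q (≤-trans le (s≤s⁻¹ lt)) lt') (depth-decreasing le l (<-trans (n<1+n q) lt'))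
  ... | inj₂ refl = dec q le lt'

  range-bounds : ∀ {pS S j₀ j₁} → IsBoundarySeq r N pS S → j₀ ≤ j₁ → j₁ < pS →
    SameInputs K (Range {r} S j₀ j₁) →
    K⊆[ start (S j₀) ⋯ lastOf (S j₁) ] × N∩[ start (S j₀) ⋯ lastOf (S j₁) ]⊆K
  range-bounds {pS} {S} {j₀} {j₁} bsS j₀≤j₁ j₁<pS same = K⊆ , ⊆K
    where
    module SS = BoundarySeq bsS
    j₀<pS : j₀ < pS
    j₀<pS = ≤-<-trans j₀≤j₁ j₁<pS
    K⊆ : K⊆[ start (S j₀) ⋯ lastOf (S j₁) ]
    K⊆ {m} m∈K with proj₁ (same m) m∈K
    ... | j , j₀≤j , j≤j₁ , p = SS.covered⇒∈ℕ (≤-<-trans j≤j₁ j₁<pS) xm , lo , hi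
      where
      xm : Covers (S j) m
      xm = In⇒Covers p
      lo : start (S j₀) ≤ m
      lo with m≤n⇒m<n∨m≡n j₀≤j
      ... | inj₁ lt = <⇒≤ (SS.left lt (≤-<-trans j≤j₁ j₁<pS) (covers-start (S j₀)) xm)
      ... | inj₂ refl = start≤ xm
      hi : m ≤ lastOf (S j₁)
      hi with m≤n⇒m<n∨m≡n j≤j₁
      ... | inj₁ lt = <⇒≤ (SS.left lt j₁<pS xm (covers-lastOf (S j₁)))
      ... | inj₂ refl = s≤s⁻¹ (subst (m <_) (sym (suc-lastOf (S j₁))) (<end xm))
    ⊆K : N∩[ start (S j₀) ⋯ lastOf (S j₁) ]⊆K
    ⊆K {m} m∈N lo hi with SS.cover m∈N
    ... | j , j<pS , xm = proj₂ (same m) (j , j₀≤j , j≤j₁ , Covers⇒In (SS.vertex j<pS) xm)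
      where
      j₀≤j : j₀ ≤ j
      j₀≤j with j₀ ≤? j
      ... | yes le = le
      ... | no ≰ = ⊥-elim (<⇒≱ (SS.left (≰⇒> ≰) j₀<pS xm (covers-start (S j₀))) lo)
      j≤j₁ : j ≤ j₁
      j≤j₁ with j ≤? j₁
      ... | yes le = le
      ... | no ≰ = ⊥-elim (<⇒≱ (SS.left (≰⇒> ≰) j<pS (covers-lastOf (S j₁)) xm) hi)

  whole-trees-cut : ∀ a Δ' nU y → qL ≡ a + suc Δ' + nU → a ≤ suc J' → (0 < nU → suc J' ≤ a + suc Δ') →
    suc y ≡ end (T' (a + Δ')) → K⊆[ start (T' a) ⋯ y ] → N∩[ start (T' a) ⋯ y ]⊆K → Cut
  whole-trees-cut a Δ' nU y qL≡ a≤J cJ end≡ K⊆ ⊆K = record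
    { a = a ; Δ = suc Δ' ; nU = nU ; t = hL ; y = y ; sM = sL ; qL≡ = qL≡ ; a≤J = a≤J ; cJ = cJ
    ; t≤hL = ≤-refl ; sM≡ = end-L ; E = inj₁ (Δ' , refl , refl , end≡) ; K⊆[x⋯y] = K⊆ ; N∩[x⋯y]⊆K = ⊆K }

  spine-cut : ∀ a Δ t y → qL ≡ a + Δ + 0 → a ≤ suc J' → t < hL → y + 2 ^ t ≡ I →
    K⊆[ start (T' a) ⋯ y ] → N∩[ start (T' a) ⋯ y ]⊆K → Cut
  spine-cut a Δ t y qL≡ a≤J t<hL y≡ K⊆ ⊆K = record
    { a = a ; Δ = Δ ; nU = 0 ; t = t ; y = y ; sM = suc y ; qL≡ = qL≡ ; a≤J = a≤J ; cJ = λ ()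
    ; t≤hL = <⇒≤ t<hL ; sM≡ = cong suc y≡ ; E = inj₂ (t<hL , refl , y≡) ; K⊆[x⋯y] = K⊆ ; N∩[x⋯y]⊆K = ⊆K }

  qL-split : ∀ {q} → q < qL → Σ ℕ λ o → qL ≡ q + 1 + o
  qL-split {q} lt with m≤n⇒∃[o]m+o≡n lt
  ... | o , eq = o , trans (sym eq) (cong (_+ o) (+-comm 1 q))

  single-T-cut : ∀ q → q < qL → J' ≤ q → q ≤ suc J' →
    K⊆[ start (T' q) ⋯ lastOf (T' q) ] → N∩[ start (T' q) ⋯ lastOf (T' q) ]⊆K → Cut
  single-T-cut q q<qL J'≤q q≤ K⊆ ⊆K with qL-split q<qL
  ... | o , eq = whole-trees-cut q 0 o (lastOf (T' q)) eq q≤ (λ _ → subst (suc J' ≤_) (+-comm 1 q) (s≤s J'≤q))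
                   (trans (suc-lastOf (T' q)) (cong (λ z → end (T' z)) (sym (+-identityʳ q)))) K⊆ ⊆K

  spine-child-last : ∀ S → start S + 2 ^ suc (depth S) ≡ suc I → lastOf S + 2 ^ depth S ≡ I
  spine-child-last S eqS = suc-injective (begin
    suc (lastOf S) + 2 ^ depth S      ≡⟨ cong (_+ 2 ^ depth S) (suc-lastOf S) ⟩
    start S + 2 ^ depth S + 2 ^ depth S ≡⟨ +-assoc (start S) _ _ ⟩
    start S + (2 ^ depth S + 2 ^ depth S) ≡⟨ cong (start S +_) (2^-suc (depth S)) ⟨
    start S + 2 ^ suc (depth S)       ≡⟨ eqS ⟩
    suc I                             ∎)
    where open ≡-Reasoning

  module FromTriSubset {n} (∣N∣≡n : ∣ N ∣ ≡ n) where

    Full⇒≤n : ∀ s l → Full N s l → l ≤ n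
    Full⇒≤n s l f = subst (l ≤_) ∣N∣≡n (Full⇒≤∣∣ N s l f)

    Full²⇒≤n : ∀ s₁ l₁ s₂ l₂ → s₁ + l₁ ≤ s₂ → Full N s₁ l₁ → Full N s₂ l₂ → l₁ + l₂ ≤ n
    Full²⇒≤n s₁ l₁ s₂ l₂ le f₁ f₂ = subst (l₁ + l₂ ≤_) ∣N∣≡n (Full²⇒≤∣∣ N s₁ l₁ s₂ l₂ le f₁ f₂)

    -- Since n < 2 ^ d, N cannot contain a tree of depth d, nor two disjoint trees
    -- of depth d - 1; this pins down where a tree of depth d - 1 can sit.
    module OneTree (d' : ℕ) (n<2^d : n < 2 ^ suc d') where

      n<2^ : ∀ {e} → suc d' ≤ e → n < 2 ^ e
      n<2^ le = <-≤-trans n<2^d (2^-mono-≤ le)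

      before-peak-too-big : ∀ q → depth (T' q) ≡ d' → q < qL → q < J' → ⊥
      before-peak-too-big q dq q<qL q<J' with m≤n⇒m<n∨m≡n q<qL
      ... | inj₁ 1+q<qL = <⇒≱ (n<2^ d<) (Full⇒≤n _ _ (Full-T 1+q<qL))
        where
        d< : suc d' ≤ depth (T' (suc q))
        d< = subst (_< depth (T' (suc q))) dq (inc q q<J')
      ... | inj₂ 1+q≡qL = <⇒≱ (n<2^ d<) (≤-trans (≤-trans (≤-reflexive (sym suc-lenL)) (+-monoˡ-≤ lenL (2^>0 (depth (T' q))))) size)
        where
        d< : suc d' ≤ hL
        d< = subst (λ z → suc d' ≤ depth (T' z)) 1+q≡qL (subst (_< depth (T' (suc q))) dq (inc q q<J'))
        T-before-L : end (T' q) ≤ sL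
        T-before-L = subst (λ z → end (T' q) ≤ start (T' z)) 1+q≡qL
                       (B'.end≤start (n<1+n q) (subst (_< p') (sym 1+q≡qL) qL<p'))
        size : 2 ^ depth (T' q) + lenL ≤ n
        size = Full²⇒≤n _ _ _ _ T-before-L (Full-T q<qL) Full-L

      after-peak-too-big : ∀ q → depth (T' (suc q)) ≡ d' → suc q < qL → suc J' ≤ q → ⊥
      after-peak-too-big q dq 1+q<qL le = <⇒≱ (n<2^ d<) (Full⇒≤n _ _ (Full-T (<-trans (n<1+n q) 1+q<qL)))
        where
        d< : suc d' ≤ depth (T' q)
        d< = subst (_< depth (T' q)) dq (dec q le (<-trans 1+q<qL qL<p'))

      T-case : ∀ q → q < qL → depth (T' q) ≡ d' →
        K⊆[ start (T' q) ⋯ lastOf (T' q) ] → N∩[ start (T' q) ⋯ lastOf (T' q) ]⊆K → Cut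
      T-case q q<qL dq K⊆ ⊆K with <-cmp q J'
      ... | tri< lt _ _ = ⊥-elim (before-peak-too-big q dq q<qL lt)
      ... | tri≈ _ refl _ = single-T-cut q q<qL ≤-refl (n≤1+n q) K⊆ ⊆K
      ... | tri> _ _ gt with m≤n⇒m<n∨m≡n gt
      ...   | inj₂ refl = single-T-cut q q<qL (n≤1+n J') ≤-refl K⊆ ⊆K
      T-case (suc q) q<qL dq K⊆ ⊆K | tri> _ _ gt | inj₁ lt = ⊥-elim (after-peak-too-big q dq q<qL (s≤s⁻¹ lt))

      hL≤1+d : hL ≤ suc d'
      hL≤1+d with hL ≤? suc d'
      ... | yes le = le
      ... | no ≰ = ⊥-elim (<⇒≱ n<lenL (Full⇒≤n _ _ Full-L))
        where
        2^[2+d]≤2^hL : suc n + 1 ≤ suc lenL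
        2^[2+d]≤2^hL = ≤-trans (+-mono-≤ n<2^d (2^>0 (suc d')))
          (≤-trans (≤-reflexive (sym (2^-suc (suc d')))) (≤-trans (2^-mono-≤ (≰⇒> ≰)) (≤-reflexive (sym suc-lenL))))
        n<lenL : n < lenL
        n<lenL = subst (_≤ lenL) (+-comm n 1) (s≤s⁻¹ 2^[2+d]≤2^hL)

      nothing-before-L : hL ≡ suc d' → qL ≡ 0
      nothing-before-L hL≡ with qL ≟ 0
      ... | yes qL≡0 = qL≡0
      ... | no qL≢0 = ⊥-elim (<⇒≱ n<1+lenL (≤-trans (+-monoˡ-≤ lenL (2^>0 (depth (T' 0))))
              (Full²⇒≤n _ _ _ _ (B'.end≤start (n≢0⇒n>0 qL≢0) qL<p') (Full-T (n≢0⇒n>0 qL≢0)) Full-L)))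
        where
        n<1+lenL : n < suc lenL
        n<1+lenL = subst (n <_) (sym suc-lenL) (subst (λ z → n < 2 ^ z) (sym hL≡) n<2^d)

      spine-case : ∀ S → depth S ≡ d' → SpineChild S →
        K⊆[ start S ⋯ lastOf S ] → N∩[ start S ⋯ lastOf S ]⊆K → Cut
      spine-case S refl (dS<hL , eqS , _) K⊆ ⊆K =
        spine-cut 0 0 d' (lastOf S) qL≡0 z≤n dS<hL (spine-child-last S eqS)
          (subst (λ z → K⊆[ z ⋯ lastOf S ]) (sym x≡) K⊆) (subst (λ z → N∩[ z ⋯ lastOf S ]⊆K) (sym x≡) ⊆K)
        where
        hL≡ : hL ≡ suc d'
        hL≡ = ≤-antisym hL≤1+d dS<hL
        qL≡0 : qL ≡ 0
        qL≡0 = nothing-before-L hL≡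
        x≡ : start (T' 0) ≡ start S
        x≡ = trans (cong (λ z → start (T' z)) (sym qL≡0))
               (+-cancelʳ-≡ (2 ^ suc d') sL (start S) (trans (cong (λ z → sL + 2 ^ z) (sym hL≡)) (trans end-L (sym eqS))))

    module TwoTrees {pS S} (bsS : IsBoundarySeq r N pS S) {j₀ j₁} (j₀<j₁ : j₀ < j₁) (j₁<pS : j₁ < pS)
        (deq : depth (S j₀) ≡ depth (S j₁)) (same : SameInputs K (Range {r} S j₀ j₁)) where

      module SS = BoundarySeq bsS

      y : ℕ
      y = lastOf (S j₁)

      start<start : start (S j₀) < start (S j₁)
      start<start = SS.left j₀<j₁ j₁<pS (covers-start _) (covers-start _)

      bounds : ∀ {q₀} → S j₀ ≡ T' q₀ → K⊆[ start (T' q₀) ⋯ y ] × N∩[ start (T' q₀) ⋯ y ]⊆K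
      bounds eq₀ = subst (λ v → K⊆[ start v ⋯ y ] × N∩[ start v ⋯ y ]⊆K) eq₀
                         (range-bounds bsS (<⇒≤ j₀<j₁) j₁<pS same)

      -- Equal depths put the two trees on opposite sides of the peak J'.
      both-T : ∀ q₀ q₁ → q₀ < qL → q₁ < qL → S j₀ ≡ T' q₀ → S j₁ ≡ T' q₁ → Cut
      both-T q₀ q₁ q₀<qL q₁<qL eq₀ eq₁ = build (m≤n⇒∃[o]m+o≡n q₀<q₁) (qL-split q₁<qL)
        where
        deq' : depth (T' q₀) ≡ depth (T' q₁)
        deq' = trans (cong depth (sym eq₀)) (trans deq (cong depth eq₁))
        q₀<q₁ : q₀ < q₁
        q₀<q₁ with q₀ <? q₁
        ... | yes lt = lt
        ... | no ≮ = ⊥-elim (<⇒≱ start<start (subst₂ (λ u v → start u ≤ start v) (sym eq₁) (sym eq₀)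
                                                (B'.start-mono (≮⇒≥ ≮) (<qL⇒<p' q₀<qL))))
        q₀≤J : q₀ ≤ J'
        q₀≤J with q₀ ≤? J'
        ... | yes le = le
        ... | no ≰ = ⊥-elim (<-irrefl (sym deq') (depth-decreasing (≰⇒> ≰) q₀<q₁ (<qL⇒<p' q₁<qL)))
        J<q₁ : J' < q₁
        J<q₁ with J' <? q₁
        ... | yes lt = lt
        ... | no ≮ = ⊥-elim (<-irrefl deq' (depth-increasing q₀<q₁ (≮⇒≥ ≮)))
        build : (Σ ℕ λ k → suc q₀ + k ≡ q₁) → (Σ ℕ λ l → qL ≡ q₁ + 1 + l) → Cut
        build (k , refl) (l , qL≡) =
          whole-trees-cut q₀ (suc k) l y qL≡' (≤-trans q₀≤J (n≤1+n J')) (λ _ → ≤-trans J<q₁ q₁≤)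
            (trans (suc-lastOf (S j₁)) (cong end (trans eq₁ (cong T' q₁≡)))) (proj₁ (bounds eq₀)) (proj₂ (bounds eq₀))
          where
          q₁≡ : suc q₀ + k ≡ q₀ + suc k
          q₁≡ = sym (+-suc q₀ k)
          2+q₀+k≡ : suc (suc (q₀ + k)) ≡ q₀ + suc (suc k)
          2+q₀+k≡ = sym (trans (+-suc q₀ (suc k)) (cong suc (+-suc q₀ k)))
          q₁≤ : suc q₀ + k ≤ q₀ + suc (suc k)
          q₁≤ = subst (suc (q₀ + k) ≤_) 2+q₀+k≡ (n≤1+n _)
          qL≡' : qL ≡ q₀ + suc (suc k) + l
          qL≡' = trans qL≡ (cong (_+ l) (trans (+-comm (suc (q₀ + k)) 1) 2+q₀+k≡))

      T-and-spine : ∀ q₀ → q₀ < qL → S j₀ ≡ T' q₀ → SpineChild (S j₁) → Cut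
      T-and-spine q₀ q₀<qL eq₀ (d₁<hL , eq₁ , _) with m≤n⇒∃[o]m+o≡n (<⇒≤ q₀<qL)
      ... | k , q₀+k≡qL = spine-cut q₀ k (depth (S j₁)) y (trans (sym q₀+k≡qL) (sym (+-identityʳ _)))
              (≤-trans q₀≤J (n≤1+n J')) d₁<hL (spine-child-last (S j₁) eq₁) (proj₁ (bounds eq₀)) (proj₂ (bounds eq₀))
        where
        q₀≤J : q₀ ≤ J'
        q₀≤J with q₀ ≤? J'
        ... | yes le = le
        ... | no ≰ = ⊥-elim (<⇒≱ d₁<hL (<⇒≤ (subst (hL <_) (trans (cong depth (sym eq₀)) deq)
                                                 (depth-decreasing (≰⇒> ≰) q₀<qL qL<p'))))

      cut : Cut
      cut with Boundary-N-classify (SS.boundary (<-trans j₀<j₁ j₁<pS)) | Boundary-N-classify (SS.boundary j₁<pS)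
      ... | inj₂ (_ , _ , S₀⊑L) | inj₁ (q₁ , q₁<qL , eq₁) =
        ⊥-elim (<⇒≱ start<start (<⇒≤ (≤-trans (subst (λ v → start v < sL) (sym eq₁) (left-of-L q₁<qL (covers-start (T' q₁))))
                                              (⊑-start S₀⊑L))))
      ... | inj₂ (_ , e₀ , _) | inj₂ (_ , e₁ , _) =
        ⊥-elim (<-irrefl (+-cancelʳ-≡ _ _ _ (trans e₀ (trans (sym e₁) (cong (λ z → start (S j₁) + 2 ^ suc z) (sym deq))))) start<start)
      ... | inj₁ (q₀ , q₀<qL , eq₀) | inj₁ (q₁ , q₁<qL , eq₁) = both-T q₀ q₁ q₀<qL q₁<qL eq₀ eq₁
      ... | inj₁ (q₀ , q₀<qL , eq₀) | inj₂ spine = T-and-spine q₀ q₀<qL eq₀ spine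

    single-range : ∀ {S : ℕ → Vertex} {j} → SameInputs K (In r (S j)) → SameInputs K (Range {r} S j j)
    single-range {j = j} same m = (λ m∈K → j , ≤-refl , ≤-refl , proj₁ (same m) m∈K) ,
                                  λ { (_ , lo , hi , p) → proj₂ (same m) (subst (λ k → In r _ m) (≤-antisym hi lo) p) }

    TriSubset⇒Cut : TriSubsetResult r N n K → Cut
    TriSubset⇒Cut (zero , () , _)
    TriSubset⇒Cut (suc d' , _ , _ , n<2^d , pS , S , bsS , inj₁ (j , j<pS , dj , same))
      with range-bounds bsS ≤-refl j<pS (single-range same) | Boundary-N-classify (BoundarySeq.boundary bsS j<pS)
    ... | K⊆ , ⊆K | inj₁ (q , q<qL , eq) = OneTree.T-case d' n<2^d q q<qL (trans (cong depth (sym eq)) dj)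
            (subst (λ v → K⊆[ start v ⋯ lastOf v ]) eq K⊆) (subst (λ v → N∩[ start v ⋯ lastOf v ]⊆K) eq ⊆K)
    ... | K⊆ , ⊆K | inj₂ spine = OneTree.spine-case d' n<2^d (S j) dj spine K⊆ ⊆K
    TriSubset⇒Cut (suc d' , _ , _ , _ , pS , S , bsS , inj₂ (_ , j₀ , j₁ , j₀<j₁ , j₁<pS , deq , _ , same)) =
      TwoTrees.cut bsS j₀<j₁ j₁<pS deq same

mainTheorem6 : (∘ : GateOp) (r : ℕ) (N : Subset r) (n : ℕ) →
    ∣ N ∣ ≡ n → 1 ≤ n → Triangular r N →
    (i : Fin r) → i ∉ N →
    (∀ a → a ∈ N → toℕ a < toℕ i) →
    Σ (Fin r) (λ a → a ∈ N × suc (toℕ a) ≡ toℕ i) →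
    Triangular r (N ∪ ⁅ i ⁆) →
    (K : Subset r) → TriSubsetResult r N n K →
    Triangular r ((N ─ K) ∪ ⁅ i ⁆)
mainTheorem6 _ r N n ∣N∣≡n _ _ i _ N<i _ (p' , T' , bs' , inj₁ p'≡0) K _ =
  ⊥-elim (<-irrefl (sym p'≡0) (BoundarySeq.nonempty bs' (∪⁺ʳ N (⁅⁆⁺ i))))
mainTheorem6 _ r N n ∣N∣≡n _ _ i _ N<i _ (p' , T' , bs' , inj₂ (J' , J'<p' , cons≤J , cons>J , inc , dec)) K result =
  Remainder.remainder-triangular (FromTriSubset.TriSubset⇒Cut ∣N∣≡n result)
  where open Extension N i N<i bs' J'<p' cons≤J cons>J inc dec K
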